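{- For each integer $n \ge 1$ let $$m(n) = \#\{x \in \mathbb{Z}_n : x^{k + \lceil \varphi(n)/2 \rceil} = x^k \text{ for some integer } k \ge 1\},$$ where $\varphi$ is Euler's totient function. Then $$m(n) = \begin{cases} 3 & \text{if } n = 4, \\ \frac{p^{r-1}(p+1)}{2} & \text{if } n = p^r \text{ with } p \text{ an odd prime and } r \ge 1, \\ p^{r-1}(p+1) & \text{if } n = 2p^r \text{ with } p \text{ an odd prime and } r \ge 1, \\ n & \text{otherwise.} \end{cases}$$
   Context: $\mathbb{Z}_n$ denotes the ring of integers modulo $n$; $\lceil \cdot \rceil$ is the ceiling function. -}

module Defs where

open import Data.Nat using (ℕ; zero; suc; _+_; _*_; _∸_; _^_; _≤_; NonZero; ⌈_/2⌉)
open import Data.Nat.DivMod using (_%_)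
open import Data.Nat.Coprimality using (Coprime; coprime?)
open import Data.Fin using (Fin; toℕ)
open import Data.List using (List; length; filter; upTo; map)
open import Data.List.Relation.Unary.Unique.Propositional using (Unique)
open import Data.List.Membership.Propositional using (_∈_)
open import Data.Product using (Σ; _×_; ∃-syntax)
open import Function.Bundles using (_⇔_)
open import Relation.Binary.PropositionalEquality using (_≡_)

totient : ℕ → ℕ
totient n = length (filter (λ k → coprime? k n) (map suc (upTo n)))

IsCounted : (n : ℕ) → .{{NonZero n}} → Fin n → Set
IsCounted n x =
  ∃[ k ] (1 ≤ k × (toℕ x ^ (k + ⌈ totient n /2⌉)) % n ≡ (toℕ x ^ k) % n)

-- "m(n) = v": the set { x ∈ ℤ_n : IsCounted n x } has exactly v elements,
-- witnessed by a duplicate-free list enumerating precisely that set.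
MEquals : (n : ℕ) → .{{NonZero n}} → ℕ → Set
MEquals n v = Σ (List (Fin n)) λ L →
  Unique L × ((x : Fin n) → (x ∈ L ⇔ IsCounted n x)) × length L ≡ v

open import Data.Nat.Primality using (Prime)
open import Relation.Nullary using (¬_)

OddPrimePower : ℕ → ℕ → ℕ → Set
OddPrimePower n p r = Prime p × ¬ (p ≡ 2) × 1 ≤ r × n ≡ p ^ r

TwiceOddPrimePower : ℕ → ℕ → ℕ → Set
TwiceOddPrimePower n p r = Prime p × ¬ (p ≡ 2) × 1 ≤ r × n ≡ 2 * p ^ r

{-# OPTIONS --safe #-}
-- Write h = ⌈φ(n)/2⌉. Modulo a prime power q^s dividing n, a multiple x of q has x^k ≡ 0 once
-- k ≥ s, and a unit x satisfies x^(k+h) ≡ x^k exactly when x^h ≡ 1. By the Chinese remainder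
-- theorem every residue is therefore counted as soon as x^h ≡ 1 for the units modulo each prime
-- power q^S exactly dividing n. This holds unless n is 4, p^r or 2p^r: if the cofactor c of q^S is
-- at least 3 then φ(c) is even, so φ(q^S) divides h; for n = 2^S with S ≥ 3, odd squares are 1
-- modulo 8 and repeated squaring gives x^(2^(S-2)) ≡ 1 modulo 2^S.
-- For n = p^r with p odd, h = φ(n)/2 and every unit has x^h ≡ ±1. Lagrange's bound on the roots
-- of x^((p-1)/2) - 1 modulo p yields a unit a with a^h ≡ -1 (Fermat's little theorem moves the
-- exponent from (p-1)/2 to h), and multiplication by a swaps the units with x^h ≡ 1 and those
-- with x^h ≡ -1. So exactly h units are counted, besides the p^(r-1) multiples of p. For n = 2p^r
-- the exponent h is the same, the condition modulo 2 holds for every k ≥ 1, and the count doubles.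

module Submission where

open import Defs
open import Data.Nat
open import Data.Nat.Properties
open import Algebra.Properties.CommutativeSemigroup +-commutativeSemigroup
  using () renaming (interchange to +-interchange)
open import Algebra.Properties.CommutativeSemigroup *-commutativeSemigroup
  using () renaming (interchange to *-interchange)
open import Data.Nat.Divisibility
open import Data.Nat.DivMod hiding (_mod_)
open import Data.Nat.Induction using (<-rec)
open import Data.Nat.Coprimality using (Coprime; coprime?; coprime-divisor; coprime-+; 1-coprimeTo)
  renaming (sym to coprime-sym)
open import Data.Product using (∃₂; ∃-syntax; _×_; _,_; proj₁; proj₂)
open import Data.Sum using (_⊎_; inj₁; inj₂; [_,_]′)
open import Data.Empty using (⊥-elim)
open import Data.Unit using (⊤; tt)
open import Relation.Nullary using (¬_; ¬?; Dec; yes; no; does; _×-dec_; _⊎-dec_; _→-dec_)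
open import Relation.Nullary.Decidable using (dec-true; dec-false; does-⇔)
open import Data.Bool using (true; false; if_then_else_)
open import Relation.Binary.Bundles using (Setoid)
open import Relation.Binary.PropositionalEquality
  using (_≡_; _≢_; refl; sym; trans; cong; cong₂; subst; subst₂; module ≡-Reasoning)
open import Relation.Unary using (Decidable)
open import Relation.Unary.Properties using (∁?; _∩?_)
open import Function using (_∘_; id; _⇔_; mk⇔; Equivalence)
open import Data.Nat.Primality
  using (Prime; euclidsLemma; prime⇒nonZero; prime⇒nonTrivial; ¬prime[1]; prime[2]; prime⇒irreducible)
open import Data.Nat.Primality.Factorisation using (factorise)
open import Data.Nat.ListAction using (product)
open import Data.Nat.ListAction.Properties using (product-↭)
open import Data.List using (List; []; _∷_; length; filter; upTo; applyUpTo; map; tabulate; allFin; _++_; [_])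
open import Data.Fin as Fin using (Fin; toℕ; fromℕ<) renaming (suc to fsuc)
open import Data.Fin.Properties using (toℕ-fromℕ<; ¬∀⟶∃¬)
open import Data.List.Properties
  using (length-++; length-map; map-tabulate; map-∘; map-upTo; ++-identityʳ; upTo-∷ʳ; filter-++)
open import Data.List.Membership.Propositional using (_∈_)
open import Data.List.Membership.Propositional.Properties
  using (∈-∃++; ∈-map⁻; ∈-allFin; ∈-++⁻; ∈-++⁺ˡ; ∈-++⁺ʳ; ∈-filter⁺; ∈-filter⁻; ∈-upTo⁺; ∈-upTo⁻)
open import Data.List.Relation.Unary.Any using (here; there)
open import Data.List.Relation.Unary.All as All using (All)
open import Data.List.Relation.Unary.All.Properties using (map⁺)
open import Data.List.Relation.Unary.Unique.Propositional using (Unique)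
open import Data.List.Relation.Unary.Unique.Propositional.Properties using (filter⁺; upTo⁺; allFin⁺)
open import Data.List.Relation.Binary.Subset.Propositional using (_⊆_)
open import Data.List.Relation.Binary.Permutation.Propositional using (_↭_; ↭-refl; ↭-prep; ↭-trans; ↭-sym)
open import Data.List.Relation.Binary.Permutation.Propositional.Properties using (shift; ↭-length)
open import Data.Nat.Tactic.RingSolver using (solve-∀; solve)

even⊎odd : ∀ n → ∃[ t ] (n ≡ t + t ⊎ n ≡ suc (t + t))
even⊎odd zero = 0 , inj₁ refl
even⊎odd (suc n) with even⊎odd n
... | t , inj₁ n≡t+t   = t , inj₂ (cong suc n≡t+t)
... | t , inj₂ n≡1+t+t = suc t , inj₁ (cong suc (trans n≡1+t+t (sym (+-suc t t))))

n+n≡n*2 : ∀ n → n + n ≡ n * 2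
n+n≡n*2 n = trans (cong (n +_) (sym (+-identityʳ n))) (*-comm 2 n)

odd⇒≡1+2t : ∀ {x} → ¬ 2 ∣ x → ∃[ t ] x ≡ suc (t + t)
odd⇒≡1+2t {x} 2∤x with even⊎odd x
... | t , inj₁ x≡t+t   = ⊥-elim (2∤x (divides t (trans x≡t+t (n+n≡n*2 t))))
... | t , inj₂ x≡1+t+t = t , x≡1+t+t

m+m≡n+n⇒m≡n : ∀ {m n} → m + m ≡ n + n → m ≡ n
m+m≡n+n⇒m≡n {m} {n} m+m≡n+n = *-cancelʳ-≡ m n 2 (trans (sym (n+n≡n*2 m)) (trans m+m≡n+n (n+n≡n*2 n)))

⌈n+n/2⌉≡n : ∀ n → ⌈ n + n /2⌉ ≡ n
⌈n+n/2⌉≡n zero    = refl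
⌈n+n/2⌉≡n (suc n) = trans (cong (λ m → ⌊ suc (suc m) /2⌋) (+-suc n n)) (cong suc (⌈n+n/2⌉≡n n))

m+n*0≡m : ∀ m n → m + n * 0 ≡ m
m+n*0≡m m n = trans (cong (m +_) (*-zeroʳ n)) (+-identityʳ m)

^-distribʳ-* : ∀ m n k → (m * n) ^ k ≡ m ^ k * n ^ k
^-distribʳ-* m n zero    = refl
^-distribʳ-* m n (suc k) = trans (cong (m * n *_) (^-distribʳ-* m n k)) (*-interchange m n _ _)

n<m^n : ∀ {m} n → 1 < m → n < m ^ n
n<m^n     zero    _   = s≤s z≤n
n<m^n {m} (suc n) 1<m = begin-strict
  suc n           <⟨ s≤s (n<m^n n 1<m) ⟩
  suc (m ^ n)     ≤⟨ m<m*n (m ^ n) m 1<m ⟩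
  m ^ n * m       ≡⟨ *-comm (m ^ n) m ⟩
  m * m ^ n       ∎
  where
  open ≤-Reasoning
  instance
    m≢0 : NonZero m
    m≢0 = >-nonZero (<-trans z<s 1<m)
    mⁿ≢0 : NonZero (m ^ n)
    mⁿ≢0 = m^n≢0 m n

m∣m^n : ∀ {m n} → 0 < n → m ∣ m ^ n
m∣m^n {m} {suc n} _ = m∣m*n (m ^ n)

^-monoʳ-∣ : ∀ x {s n} → s ≤ n → x ^ s ∣ x ^ n
^-monoʳ-∣ x {s} {n} s≤n =
  divides (x ^ (n ∸ s)) (trans (cong (x ^_) (sym (m∸n+n≡m s≤n))) (^-distribˡ-+-* x (n ∸ s) s))

^-monoˡ-∣ : ∀ {p x} r → p ∣ x → p ^ r ∣ x ^ r
^-monoˡ-∣ zero    _   = ∣-refl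
^-monoˡ-∣ (suc r) p∣x = *-pres-∣ p∣x (^-monoˡ-∣ r p∣x)

-- Congruences

infix 4 _≡_mod_

-- A multiple of n on each side avoids truncated subtraction; the relation makes sense for every n.
_≡_mod_ : ℕ → ℕ → ℕ → Set
a ≡ b mod n = ∃₂ λ i j → a + i * n ≡ b + j * n

module _ {n : ℕ} where

  mod-reflexive : ∀ {a b} → a ≡ b → a ≡ b mod n
  mod-reflexive refl = 0 , 0 , refl

  mod-refl : ∀ {a} → a ≡ a mod n
  mod-refl = mod-reflexive refl

  mod-sym : ∀ {a b} → a ≡ b mod n → b ≡ a mod n
  mod-sym (i , j , e) = j , i , sym e

  mod-trans : ∀ {a b c} → a ≡ b mod n → b ≡ c mod n → a ≡ c mod n
  mod-trans {a} {b} {c} (i , j , e₁) (k , l , e₂) = i + k , l + j , (begin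
    a + (i + k) * n     ≡⟨ solve (a ∷ i ∷ k ∷ n ∷ []) ⟩
    (a + i * n) + k * n ≡⟨ cong (_+ k * n) e₁ ⟩
    (b + j * n) + k * n ≡⟨ solve (b ∷ j ∷ k ∷ n ∷ []) ⟩
    (b + k * n) + j * n ≡⟨ cong (_+ j * n) e₂ ⟩
    (c + l * n) + j * n ≡⟨ solve (c ∷ l ∷ j ∷ n ∷ []) ⟩
    c + (l + j) * n     ∎)
    where open ≡-Reasoning

  +-cong-mod : ∀ {a b c d} → a ≡ b mod n → c ≡ d mod n → a + c ≡ b + d mod n
  +-cong-mod {a} {b} {c} {d} (i , j , e₁) (k , l , e₂) = i + k , j + l , (begin
    (a + c) + (i + k) * n     ≡⟨ solve (a ∷ c ∷ i ∷ k ∷ n ∷ []) ⟩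
    (a + i * n) + (c + k * n) ≡⟨ cong₂ _+_ e₁ e₂ ⟩
    (b + j * n) + (d + l * n) ≡⟨ solve (b ∷ d ∷ j ∷ l ∷ n ∷ []) ⟩
    (b + d) + (j + l) * n     ∎)
    where open ≡-Reasoning

  *-cong-mod : ∀ {a b c d} → a ≡ b mod n → c ≡ d mod n → a * c ≡ b * d mod n
  *-cong-mod {a} {b} {c} {d} (i , j , e₁) (k , l , e₂) =
    a * k + i * c + i * k * n , b * l + j * d + j * l * n , (begin
      a * c + (a * k + i * c + i * k * n) * n ≡⟨ solve (a ∷ c ∷ i ∷ k ∷ n ∷ []) ⟩
      (a + i * n) * (c + k * n)               ≡⟨ cong₂ _*_ e₁ e₂ ⟩
      (b + j * n) * (d + l * n)               ≡⟨ solve (b ∷ d ∷ j ∷ l ∷ n ∷ []) ⟩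
      b * d + (b * l + j * d + j * l * n) * n ∎)
    where open ≡-Reasoning

  ^-cong-mod : ∀ {a b} k → a ≡ b mod n → a ^ k ≡ b ^ k mod n
  ^-cong-mod zero    _   = mod-refl
  ^-cong-mod (suc k) a≡b = *-cong-mod a≡b (^-cong-mod k a≡b)

  m+kn≡m-mod : ∀ m k → m + k * n ≡ m mod n
  m+kn≡m-mod m k = 0 , k , +-identityʳ _

  ∣⇒≡0-mod : ∀ {a} → n ∣ a → a ≡ 0 mod n
  ∣⇒≡0-mod (divides k refl) = m+kn≡m-mod 0 k

  n≡0-mod : n ≡ 0 mod n
  n≡0-mod = ∣⇒≡0-mod ∣-refl

  ≡0-mod⇒∣ : ∀ {a} → a ≡ 0 mod n → n ∣ a
  ≡0-mod⇒∣ {a} (i , j , e) = divides (j ∸ i) (begin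
    a                 ≡⟨ m+n∸n≡m a (i * n) ⟨
    a + i * n ∸ i * n ≡⟨ cong (_∸ i * n) e ⟩
    j * n ∸ i * n     ≡⟨ *-distribʳ-∸ n j i ⟨
    (j ∸ i) * n       ∎)
    where open ≡-Reasoning

  ∣m∸k⇒≡-mod : ∀ {m k} → k ≤ m → n ∣ m ∸ k → m ≡ k mod n
  ∣m∸k⇒≡-mod {m} {k} k≤m n∣m∸k = mod-trans (mod-reflexive (sym (m∸n+n≡m k≤m)))
    (+-cong-mod (∣⇒≡0-mod n∣m∸k) (mod-refl {k}))

  ≡-mod⇒∣m∸k : ∀ {m k} → k ≤ m → m ≡ k mod n → n ∣ m ∸ k
  ≡-mod⇒∣m∸k {m} {k} k≤m (i , j , e) = ≡0-mod⇒∣ (i , j , +-cancelˡ-≡ k _ _ (begin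
    k + (m ∸ k + i * n) ≡⟨ +-assoc k (m ∸ k) _ ⟨
    k + (m ∸ k) + i * n ≡⟨ cong (_+ i * n) (m+[n∸m]≡n k≤m) ⟩
    m + i * n           ≡⟨ e ⟩
    k + j * n           ∎))
    where open ≡-Reasoning

  mod-cancelˡ : ∀ {c a b} → Coprime n c → c * a ≡ c * b mod n → a ≡ b mod n
  mod-cancelˡ {c} {a} {b} n⊥c ca≡cb = [ (λ b≤a → cancel b≤a ca≡cb)
                                      , (λ a≤b → mod-sym (cancel a≤b (mod-sym ca≡cb))) ]′ (≤-total b a)
    where
    cancel : ∀ {a b} → b ≤ a → c * a ≡ c * b mod n → a ≡ b mod n
    cancel {a} {b} b≤a ca≡cb = ∣m∸k⇒≡-mod b≤a (coprime-divisor n⊥c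
      (subst (n ∣_) (sym (*-distribˡ-∸ c a b)) (≡-mod⇒∣m∸k (*-monoʳ-≤ c b≤a) ca≡cb)))

mod-setoid : ℕ → Setoid _ _
mod-setoid n = record
  { Carrier = ℕ
  ; _≈_ = _≡_mod n
  ; isEquivalence = record { refl = mod-refl ; sym = mod-sym ; trans = mod-trans }
  }

module ≡-mod-Reasoning (n : ℕ) where
  open import Relation.Binary.Reasoning.Setoid (mod-setoid n) public

mod-∣ : ∀ {m n a b} → m ∣ n → a ≡ b mod n → a ≡ b mod m
mod-∣ {m} {n} {a} {b} (divides q refl) (i , j , e) = i * q , j * q ,
  trans (cong (a +_) (*-assoc i q m)) (trans e (cong (b +_) (sym (*-assoc j q m))))

≡-mod1 : ∀ a b → a ≡ b mod 1
≡-mod1 a b = b , a , (begin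
  a + b * 1 ≡⟨ cong (a +_) (*-identityʳ b) ⟩
  a + b     ≡⟨ +-comm a b ⟩
  b + a     ≡⟨ cong (b +_) (*-identityʳ a) ⟨
  b + a * 1 ∎)
  where open ≡-Reasoning

module _ {n : ℕ} .{{_ : NonZero n}} where

  ≡-mod⇒%≡ : ∀ {a b} → a ≡ b mod n → a % n ≡ b % n
  ≡-mod⇒%≡ {a} {b} (i , j , e) = begin
    a % n           ≡⟨ [m+kn]%n≡m%n a i n ⟨
    (a + i * n) % n ≡⟨ cong (_% n) e ⟩
    (b + j * n) % n ≡⟨ [m+kn]%n≡m%n b j n ⟩
    b % n           ∎
    where open ≡-Reasoning

  m%n≡m-mod : ∀ m → m % n ≡ m mod n
  m%n≡m-mod m = mod-sym (mod-trans (mod-reflexive (m≡m%n+[m/n]*n m n)) (m+kn≡m-mod (m % n) (m / n)))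

  %≡⇒≡-mod : ∀ {a b} → a % n ≡ b % n → a ≡ b mod n
  %≡⇒≡-mod {a} {b} e = mod-trans (mod-sym (m%n≡m-mod a)) (mod-trans (mod-reflexive e) (m%n≡m-mod b))

  <∧≡-mod⇒≡ : ∀ {a b} → a < n → b < n → a ≡ b mod n → a ≡ b
  <∧≡-mod⇒≡ {a} {b} a<n b<n a≡b =
    trans (sym (m<n⇒m%n≡m a<n)) (trans (≡-mod⇒%≡ a≡b) (m<n⇒m%n≡m b<n))

infix 4 _≡?_mod_

_≡?_mod_ : ∀ a b n .{{_ : NonZero n}} → Dec (a ≡ b mod n)
a ≡? b mod n with a % n ≟ b % n
... | yes a%n≡b%n = yes (%≡⇒≡-mod a%n≡b%n)
... | no  a%n≢b%n = no (a%n≢b%n ∘ ≡-mod⇒%≡)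

coprime-∣∧∣⇒*∣ : ∀ {m n x} → Coprime m n → m ∣ x → n ∣ x → m * n ∣ x
coprime-∣∧∣⇒*∣ {m} {n} m⊥n (divides q refl) n∣qm = subst (m * n ∣_) (*-comm m q)
  (*-monoʳ-∣ m (coprime-divisor (coprime-sym m⊥n) (subst (n ∣_) (*-comm q m) n∣qm)))

chinese-remainder : ∀ {m n a b} → Coprime m n → a ≡ b mod m → a ≡ b mod n → a ≡ b mod m * n
chinese-remainder {m} {n} {a} {b} m⊥n a≡b[m] a≡b[n] =
  [ (λ b≤a → crt b≤a a≡b[m] a≡b[n])
  , (λ a≤b → mod-sym (crt a≤b (mod-sym a≡b[m]) (mod-sym a≡b[n]))) ]′ (≤-total b a)
  where
  crt : ∀ {a b} → b ≤ a → a ≡ b mod m → a ≡ b mod n → a ≡ b mod m * n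
  crt b≤a a≡b[m] a≡b[n] =
    ∣m∸k⇒≡-mod b≤a (coprime-∣∧∣⇒*∣ m⊥n (≡-mod⇒∣m∸k b≤a a≡b[m]) (≡-mod⇒∣m∸k b≤a a≡b[n]))

^-≡1-mod : ∀ {n x} k → x ≡ 1 mod n → x ^ k ≡ 1 mod n
^-≡1-mod k x≡1 = mod-trans (^-cong-mod k x≡1) (mod-reflexive (^-zeroˡ k))

odd⇒≡1-mod2 : ∀ x → ¬ 2 ∣ x → x ≡ 1 mod 2
odd⇒≡1-mod2 x 2∤x with odd⇒≡1+2t 2∤x
... | t , refl = mod-trans (mod-reflexive (cong suc (n+n≡n*2 t))) (m+kn≡m-mod 1 t)

module _ {n : ℕ} (x : ℕ) where

  ^≡1⇒^+≡^ : ∀ k H → x ^ H ≡ 1 mod n → x ^ (k + H) ≡ x ^ k mod n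
  ^≡1⇒^+≡^ k H xᴴ≡1 = begin
    x ^ (k + H)     ≡⟨ ^-distribˡ-+-* x k H ⟩
    x ^ k * x ^ H   ≈⟨ *-cong-mod (mod-refl {n} {x ^ k}) xᴴ≡1 ⟩
    x ^ k * 1       ≡⟨ *-identityʳ (x ^ k) ⟩
    x ^ k           ∎
    where open ≡-mod-Reasoning n

  ^≡0⇒^+≡^ : ∀ k H → x ^ k ≡ 0 mod n → x ^ (k + H) ≡ x ^ k mod n
  ^≡0⇒^+≡^ k H xᵏ≡0 = begin
    x ^ (k + H)     ≡⟨ ^-distribˡ-+-* x k H ⟩
    x ^ k * x ^ H   ≈⟨ *-cong-mod xᵏ≡0 (mod-refl {n} {x ^ H}) ⟩
    0               ≈⟨ xᵏ≡0 ⟨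
    x ^ k           ∎
    where open ≡-mod-Reasoning n

^suc≡-mod2 : ∀ x j → x ^ suc j ≡ x mod 2
^suc≡-mod2 x j with 2 ∣? x
... | yes 2∣x = mod-trans (*-cong-mod (∣⇒≡0-mod 2∣x) (mod-refl {2} {x ^ j})) (mod-sym (∣⇒≡0-mod 2∣x))
... | no  2∤x = mod-trans (^-≡1-mod (suc j) (odd⇒≡1-mod2 x 2∤x)) (mod-sym (odd⇒≡1-mod2 x 2∤x))

^[k+H]≡^k-mod2 : ∀ x H k → 1 ≤ k → x ^ (k + H) ≡ x ^ k mod 2
^[k+H]≡^k-mod2 x H (suc k) _ = mod-trans (^suc≡-mod2 x (k + H)) (mod-sym (^suc≡-mod2 x k))

module _ {n : ℕ} where

  1≢-1-mod : ∀ {y} → 3 ≤ n → y ≡ 1 mod n → ¬ y + 1 ≡ 0 mod n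
  1≢-1-mod 3≤n y≡1 y+1≡0 =
    <⇒≱ 3≤n (∣⇒≤ (≡0-mod⇒∣ (mod-trans (+-cong-mod (mod-sym y≡1) (mod-refl {n} {1})) y+1≡0)))

  -1*1≡-1-mod : ∀ {y z} → y + 1 ≡ 0 mod n → z ≡ 1 mod n → y * z + 1 ≡ 0 mod n
  -1*1≡-1-mod {y} {z} y≡-1 z≡1 = begin
    y * z + 1   ≈⟨ +-cong-mod (*-cong-mod (mod-refl {n} {y}) z≡1) (mod-refl {n} {1}) ⟩
    y * 1 + 1   ≡⟨ cong (_+ 1) (*-identityʳ y) ⟩
    y + 1       ≈⟨ y≡-1 ⟩
    0           ∎
    where open ≡-mod-Reasoning n

  -1*-1≡1-mod : ∀ {y z} → y + 1 ≡ 0 mod n → z + 1 ≡ 0 mod n → y * z ≡ 1 mod n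
  -1*-1≡1-mod {y} {z} y≡-1 z≡-1 = begin
    y * z                              ≡⟨ trans (+-identityʳ _) (+-identityʳ (y * z)) ⟨
    y * z + 0 + 0                      ≈⟨ +-cong-mod (+-cong-mod (mod-refl {n} {y * z}) y≡-1) z≡-1 ⟨
    y * z + (y + 1) + (z + 1)          ≡⟨ expand y z ⟩
    (y + 1) * (z + 1) + 1              ≈⟨ +-cong-mod (*-cong-mod y≡-1 z≡-1) (mod-refl {n} {1}) ⟩
    1                                  ∎
    where
    open ≡-mod-Reasoning n
    expand : ∀ y z → y * z + (y + 1) + (z + 1) ≡ (y + 1) * (z + 1) + 1
    expand = solve-∀

-- Primes and coprimality

prime>1 : ∀ {p} → Prime p → 1 < p
prime>1 {p} p-prime = nonTrivial⇒n>1 p {{prime⇒nonTrivial p-prime}}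

∃prime∣ : ∀ {d} → 1 < d → ∃[ q ] Prime q × q ∣ d
∃prime∣ {d@(suc _)} 1<d with factorise d
... | record { factors = [] ; isFactorisation = d≡1 } = ⊥-elim (<⇒≢ 1<d (sym d≡1))
... | record { factors = q ∷ qs ; isFactorisation = d≡q*qs ; factorsPrime = q-prime All.∷ _ } =
  q , q-prime , subst (q ∣_) (sym d≡q*qs) (m∣m*n (product qs))

prime∣prime⇒≡ : ∀ {p q} → Prime p → Prime q → q ∣ p → q ≡ p
prime∣prime⇒≡ p-prime q-prime q∣p with prime⇒irreducible p-prime q∣p
... | inj₁ refl = ⊥-elim (¬prime[1] q-prime)
... | inj₂ q≡p  = q≡p

prime∣^⇒∣ : ∀ {q x} k → Prime q → q ∣ x ^ k → q ∣ x
prime∣^⇒∣ zero    q-prime q∣1 = ⊥-elim (¬prime[1] (subst Prime (∣1⇒≡1 q∣1) q-prime))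
prime∣^⇒∣ {x = x} (suc k) q-prime q∣xᵏ⁺¹ with euclidsLemma x (x ^ k) q-prime q∣xᵏ⁺¹
... | inj₁ q∣x  = q∣x
... | inj₂ q∣xᵏ = prime∣^⇒∣ k q-prime q∣xᵏ

coprime⇒¬prime∣ : ∀ {a b q} → Coprime a b → Prime q → q ∣ a → ¬ q ∣ b
coprime⇒¬prime∣ a⊥b q-prime q∣a q∣b = ¬prime[1] (subst Prime (a⊥b (q∣a , q∣b)) q-prime)

¬prime∣⇒coprime : ∀ {a b} → (∀ {q} → Prime q → q ∣ a → ¬ q ∣ b) → Coprime a b
¬prime∣⇒coprime no-common {0} (0∣a , 0∣b) =
  ⊥-elim (no-common prime[2] (∣-trans (2 ∣0) 0∣a) (∣-trans (2 ∣0) 0∣b))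
¬prime∣⇒coprime no-common {1} _ = refl
¬prime∣⇒coprime no-common {suc (suc d)} (d∣a , d∣b) with ∃prime∣ {suc (suc d)} (s≤s (s≤s z≤n))
... | q , q-prime , q∣d = ⊥-elim (no-common q-prime (∣-trans q∣d d∣a) (∣-trans q∣d d∣b))

coprime-*ˡ : ∀ {a b c} → Coprime a c → Coprime b c → Coprime (a * b) c
coprime-*ˡ {a} {b} a⊥c b⊥c = ¬prime∣⇒coprime λ q-prime q∣ab q∣c →
  [ (λ q∣a → coprime⇒¬prime∣ a⊥c q-prime q∣a q∣c)
  , (λ q∣b → coprime⇒¬prime∣ b⊥c q-prime q∣b q∣c) ]′ (euclidsLemma a b q-prime q∣ab)

coprime-^ˡ : ∀ {a c} k → Coprime a c → Coprime (a ^ k) c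
coprime-^ˡ {c = c} zero    _   = 1-coprimeTo c
coprime-^ˡ         (suc k) a⊥c = coprime-*ˡ a⊥c (coprime-^ˡ k a⊥c)

prime∤⇒coprime : ∀ {p z} → Prime p → ¬ p ∣ z → Coprime p z
prime∤⇒coprime p-prime p∤z = ¬prime∣⇒coprime λ q-prime q∣p q∣z →
  p∤z (subst (_∣ _) (prime∣prime⇒≡ p-prime q-prime q∣p) q∣z)

prime∤⇒coprime-^ : ∀ {p z} r → Prime p → ¬ p ∣ z → Coprime (p ^ r) z
prime∤⇒coprime-^ r p-prime p∤z = coprime-^ˡ r (prime∤⇒coprime p-prime p∤z)

coprime-% : ∀ {a n} .{{_ : NonZero n}} → Coprime a n → Coprime (a % n) n
coprime-% a⊥n (d∣a%n , d∣n) = a⊥n (∣n∣m%n⇒∣m d∣n d∣a%n , d∣n)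

coprime-*ʳ⇔ : ∀ {x a b} → Coprime x (a * b) ⇔ (Coprime x a × Coprime x b)
coprime-*ʳ⇔ {x} {a} {b} = mk⇔ split join
  where
  split : Coprime x (a * b) → Coprime x a × Coprime x b
  split x⊥ab = (λ (d∣x , d∣a) → x⊥ab (d∣x , ∣m⇒∣m*n b d∣a)) , (λ (d∣x , d∣b) → x⊥ab (d∣x , ∣n⇒∣m*n a d∣b))
  join : Coprime x a × Coprime x b → Coprime x (a * b)
  join (x⊥a , x⊥b) = coprime-sym (coprime-*ˡ (coprime-sym x⊥a) (coprime-sym x⊥b))

coprime-%ˡ⇔ : ∀ {x a} .{{_ : NonZero a}} → Coprime (x % a) a ⇔ Coprime x a
coprime-%ˡ⇔ = mk⇔ (λ x%a⊥a {d} (d∣x , d∣a) → x%a⊥a (%-presˡ-∣ d∣x d∣a , d∣a)) coprime-%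

factor-out : ∀ q → 1 < q → ∀ m → 0 < m → ∃₂ λ s c → m ≡ q ^ s * c × ¬ q ∣ c
factor-out q 1<q = <-rec (λ m → 0 < m → ∃₂ λ s c → m ≡ q ^ s * c × ¬ q ∣ c) step
  where
  step : ∀ m → (∀ {k} → k < m → 0 < k → ∃₂ λ s c → k ≡ q ^ s * c × ¬ q ∣ c) → 0 < m →
         ∃₂ λ s c → m ≡ q ^ s * c × ¬ q ∣ c
  step m rec 0<m with q ∣? m
  ... | no  q∤m = 0 , m , sym (+-identityʳ m) , q∤m
  ... | yes (divides k m≡k*q) =
    let s , c , k≡q^s*c , q∤c = rec k<m 0<k
    in suc s , c , trans m≡k*q (trans (cong (_* q) k≡q^s*c) (regroup q (q ^ s) c)) , q∤c
    where
    0<k : 0 < k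
    0<k = n≢0⇒n>0 λ k≡0 → <⇒≢ 0<m (sym (trans m≡k*q (cong (_* q) k≡0)))
    k<m : k < m
    k<m = subst (k <_) (sym m≡k*q) (m<m*n k q {{>-nonZero 0<k}} 1<q)
    regroup : ∀ q a c → a * c * q ≡ q * a * c
    regroup = solve-∀

∃prime-power-factor : ∀ m → 1 < m → ∃[ q ] ∃[ s ] ∃[ c ] Prime q × 0 < s × m ≡ q ^ s * c × ¬ q ∣ c
∃prime-power-factor m 1<m =
  let q , q-prime , q∣m = ∃prime∣ 1<m
      s , c , m≡q^s*c , q∤c = factor-out q (prime>1 q-prime) m (<-trans z<s 1<m)
  in q , s , c , q-prime ,
     n≢0⇒n>0 (λ s≡0 → q∤c (subst (q ∣_) (trans m≡q^s*c (trans (cong (λ e → q ^ e * c) s≡0) (*-identityˡ c)))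
                                 q∣m)) ,
     m≡q^s*c , q∤c

cofactor< : ∀ {m q s c} → 1 < q → 0 < s → 0 < m → m ≡ q ^ s * c → c < m
cofactor< {m} {q} {s} {c} 1<q s>0 m>0 m≡q^s*c =
  subst (c <_) (trans (*-comm c (q ^ s)) (sym m≡q^s*c)) (m<m*n c (q ^ s) {{c≢0}} (≤-<-trans s>0 (n<m^n s 1<q)))
  where
  c≢0 : NonZero c
  c≢0 = >-nonZero (n≢0⇒n>0 λ c≡0 →
    <⇒≢ m>0 (sym (trans m≡q^s*c (trans (cong (q ^ s *_) c≡0) (*-zeroʳ (q ^ s))))))

[1+z]²≡1⇒∣z[z+2] : ∀ {n} z → suc z * suc z ≡ 1 mod n → n ∣ z * (z + 2)
[1+z]²≡1⇒∣z[z+2] {n} z [1+z]²≡1 = subst (n ∣_) (cong (_∸ 1) (square z)) (≡-mod⇒∣m∸k (s≤s z≤n) [1+z]²≡1)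
  where
  square : ∀ z → suc z * suc z ≡ 1 + z * (z + 2)
  square = solve-∀

square≡1⇒≡±1 : ∀ {p} r y → Prime p → p ≢ 2 → y * y ≡ 1 mod p ^ r →
               y ≡ 1 mod p ^ r ⊎ y + 1 ≡ 0 mod p ^ r
square≡1⇒≡±1     r zero    _       _   0≡1  = inj₂ (mod-sym 0≡1)
square≡1⇒≡±1 {p} r (suc z) p-prime p≢2 y²≡1 with p ∣? z
... | yes p∣z = inj₁ (mod-trans (mod-reflexive (+-comm 1 z)) (+-cong-mod (∣⇒≡0-mod p^r∣z) (mod-refl {p ^ r} {1})))
  where
  p∤z+2 : ¬ p ∣ z + 2
  p∤z+2 p∣z+2 = p≢2 (prime∣prime⇒≡ prime[2] p-prime (∣m+n∣m⇒∣n p∣z+2 p∣z))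
  p^r∣z : p ^ r ∣ z
  p^r∣z = coprime-divisor (prime∤⇒coprime-^ r p-prime p∤z+2)
                          (subst (p ^ r ∣_) (*-comm z (z + 2)) ([1+z]²≡1⇒∣z[z+2] z y²≡1))
... | no p∤z = inj₂ (mod-trans (mod-reflexive (trans (+-comm (suc z) 1) (+-comm 2 z)))
                               (∣⇒≡0-mod (coprime-divisor (prime∤⇒coprime-^ r p-prime p∤z)
                                                          ([1+z]²≡1⇒∣z[z+2] z y²≡1))))

module _ {A : Set} where
  open import Data.List.Relation.Unary.AllPairs using ([]; _∷_)

  unique-⊆⇒↭++ : ∀ {xs ys : List A} → Unique xs → xs ⊆ ys → ∃[ zs ] ys ↭ xs ++ zs
  unique-⊆⇒↭++ {[]}     {ys} _ _ = ys , ↭-refl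
  unique-⊆⇒↭++ {x ∷ xs} (x∉xs ∷ xs!) x∷xs⊆ys with ∈-∃++ (x∷xs⊆ys (here refl))
  ... | as , bs , refl =
    let zs , as++bs↭xs++zs = unique-⊆⇒↭++ xs! xs⊆as++bs
    in zs , ↭-trans (shift x as bs) (↭-prep x as++bs↭xs++zs)
    where
    xs⊆as++bs : xs ⊆ as ++ bs
    xs⊆as++bs z∈xs with ∈-++⁻ as (x∷xs⊆ys (there z∈xs))
    ... | inj₁ z∈as         = ∈-++⁺ˡ z∈as
    ... | inj₂ (here z≡x)   = ⊥-elim (All.lookup x∉xs z∈xs (sym z≡x))
    ... | inj₂ (there z∈bs) = ∈-++⁺ʳ as z∈bs

  unique-⊆⇒length≤ : ∀ {xs ys : List A} → Unique xs → xs ⊆ ys → length xs ≤ length ys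
  unique-⊆⇒length≤ {xs} xs! xs⊆ys with zs , ys↭xs++zs ← unique-⊆⇒↭++ xs! xs⊆ys =
    subst (length xs ≤_) (sym (trans (↭-length ys↭xs++zs) (length-++ xs))) (m≤m+n _ _)

  unique-⊆∧length≤⇒↭ : ∀ {xs ys : List A} → Unique xs → xs ⊆ ys → length ys ≤ length xs → xs ↭ ys
  unique-⊆∧length≤⇒↭ {xs} {ys} xs! xs⊆ys ys≤xs with unique-⊆⇒↭++ xs! xs⊆ys
  ... | [] , ys↭xs++[] = ↭-sym (subst (ys ↭_) (++-identityʳ xs) ys↭xs++[])
  ... | z ∷ zs , ys↭xs++z∷zs = ⊥-elim (<⇒≱ xs<ys ys≤xs)
    where
    xs<ys : length xs < length ys
    xs<ys = subst (length xs <_) (sym (trans (↭-length ys↭xs++z∷zs) (length-++ xs))) (m<m+n (length xs) z<s)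

  map⁺-injectiveOn : ∀ {B : Set} (f : A → B) {xs} → Unique xs →
                     (∀ {a b} → a ∈ xs → b ∈ xs → f a ≡ f b → a ≡ b) → Unique (map f xs)
  map⁺-injectiveOn f []          _   = []
  map⁺-injectiveOn f (x∉xs ∷ xs!) inj =
    map⁺ (All.tabulate λ y∈xs fx≡fy → All.lookup x∉xs y∈xs (inj (here refl) (there y∈xs) fx≡fy))
    ∷ map⁺-injectiveOn f xs! (λ a∈xs b∈xs → inj (there a∈xs) (there b∈xs))

-- Counting

⟦_⟧ : {A : Set} → Dec A → ℕ
⟦ A? ⟧ = if does A? then 1 else 0

⟦⟧-yes : ∀ {A : Set} (A? : Dec A) → A → ⟦ A? ⟧ ≡ 1
⟦⟧-yes A? a rewrite dec-true A? a = refl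

⟦⟧-no : ∀ {A : Set} (A? : Dec A) → ¬ A → ⟦ A? ⟧ ≡ 0
⟦⟧-no A? ¬a rewrite dec-false A? ¬a = refl

⟦⟧-cong : ∀ {A B : Set} → A ⇔ B → (A? : Dec A) (B? : Dec B) → ⟦ A? ⟧ ≡ ⟦ B? ⟧
⟦⟧-cong A⇔B A? B? = cong (λ b → if b then 1 else 0) (does-⇔ A⇔B A? B?)

select : {P : ℕ → Set} → Decidable P → ℕ → List ℕ
select P? n = filter P? (upTo n)

count : {P : ℕ → Set} → Decidable P → ℕ → ℕ
count P? n = length (select P? n)

module _ {P : ℕ → Set} (P? : Decidable P) where

  ∈-select⁺ : ∀ {n i} → i < n → P i → i ∈ select P? n
  ∈-select⁺ i<n Pi = ∈-filter⁺ P? (∈-upTo⁺ i<n) Pi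

  ∈-select⁻ : ∀ {n i} → i ∈ select P? n → i < n × P i
  ∈-select⁻ i∈sel = let i∈upTo , Pi = ∈-filter⁻ P? i∈sel in ∈-upTo⁻ i∈upTo , Pi

  select-unique : ∀ n → Unique (select P? n)
  select-unique n = filter⁺ P? (upTo⁺ n)

  count-suc : ∀ n → count P? (suc n) ≡ ⟦ P? n ⟧ + count P? n
  count-suc n = begin
    length (filter P? (upTo (suc n)))              ≡⟨ cong (length ∘ filter P?) (upTo-∷ʳ n) ⟨
    length (filter P? (upTo n ++ [ n ]))           ≡⟨ cong length (filter-++ P? (upTo n) [ n ]) ⟩
    length (filter P? (upTo n) ++ filter P? [ n ]) ≡⟨ length-++ (filter P? (upTo n)) ⟩
    count P? n + length (filter P? [ n ])          ≡⟨ cong (count P? n +_) length-filter-[n] ⟩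
    count P? n + ⟦ P? n ⟧                          ≡⟨ +-comm (count P? n) _ ⟩
    ⟦ P? n ⟧ + count P? n                          ∎
    where
    open ≡-Reasoning
    length-filter-[n] : length (filter P? [ n ]) ≡ ⟦ P? n ⟧
    length-filter-[n] with does (P? n)
    ... | true  = refl
    ... | false = refl

module _ {P : ℕ → Set} (P? : Decidable P) where

  count-none : ∀ n → (∀ i → i < n → ¬ P i) → count P? n ≡ 0
  count-none zero    _    = refl
  count-none (suc n) none = begin
    count P? (suc n)      ≡⟨ count-suc P? n ⟩
    ⟦ P? n ⟧ + count P? n ≡⟨ cong₂ _+_ (⟦⟧-no (P? n) (none n ≤-refl))
                                       (count-none n (λ i i<n → none i (m≤n⇒m≤1+n i<n))) ⟩
    0                     ∎
    where open ≡-Reasoning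

  count-all : ∀ n → (∀ i → i < n → P i) → count P? n ≡ n
  count-all zero    _   = refl
  count-all (suc n) all = begin
    count P? (suc n)      ≡⟨ count-suc P? n ⟩
    ⟦ P? n ⟧ + count P? n ≡⟨ cong₂ _+_ (⟦⟧-yes (P? n) (all n ≤-refl))
                                       (count-all n (λ i i<n → all i (m≤n⇒m≤1+n i<n))) ⟩
    suc n                 ∎
    where open ≡-Reasoning

  count-+ : ∀ m n → count P? (m + n) ≡ count P? m + count (P? ∘ (m +_)) n
  count-+ m zero = trans (cong (count P?) (+-identityʳ m)) (sym (+-identityʳ _))
  count-+ m (suc n) = begin
    count P? (m + suc n)                                  ≡⟨ cong (count P?) (+-suc m n) ⟩
    count P? (suc (m + n))                                ≡⟨ count-suc P? (m + n) ⟩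
    ⟦ P? (m + n) ⟧ + count P? (m + n)                     ≡⟨ cong (⟦ P? (m + n) ⟧ +_) (count-+ m n) ⟩
    ⟦ P? (m + n) ⟧ + (count P? m + count (P? ∘ (m +_)) n) ≡⟨ x+[y+z]≡y+[x+z] ⟦ P? (m + n) ⟧ (count P? m) _ ⟩
    count P? m + (⟦ P? (m + n) ⟧ + count (P? ∘ (m +_)) n) ≡⟨ cong (count P? m +_) (count-suc (P? ∘ (m +_)) n) ⟨
    count P? m + count (P? ∘ (m +_)) (suc n)              ∎
    where
    open ≡-Reasoning
    x+[y+z]≡y+[x+z] : ∀ x y z → x + (y + z) ≡ y + (x + z)
    x+[y+z]≡y+[x+z] = solve-∀

  count-complement : ∀ n → count P? n + count (∁? P?) n ≡ n
  count-complement zero = refl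
  count-complement (suc n) = begin
    count P? (suc n) + count (∁? P?) (suc n)                  ≡⟨ cong₂ _+_ (count-suc P? n) (count-suc (∁? P?) n) ⟩
    (⟦ P? n ⟧ + count P? n) + (⟦ ∁? P? n ⟧ + count (∁? P?) n) ≡⟨ +-interchange ⟦ P? n ⟧ _ _ _ ⟩
    (⟦ P? n ⟧ + ⟦ ∁? P? n ⟧) + (count P? n + count (∁? P?) n) ≡⟨ cong₂ _+_ ⟦P⟧+⟦∁P⟧≡1 (count-complement n) ⟩
    suc n                                                      ∎
    where
    open ≡-Reasoning
    ⟦P⟧+⟦∁P⟧≡1 : ⟦ P? n ⟧ + ⟦ ∁? P? n ⟧ ≡ 1
    ⟦P⟧+⟦∁P⟧≡1 with P? n
    ... | yes _ = refl
    ... | no _  = refl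

  module _ {Q : ℕ → Set} (Q? : Decidable Q) where

    count-cong : ∀ n → (∀ i → i < n → P i ⇔ Q i) → count P? n ≡ count Q? n
    count-cong zero    _    = refl
    count-cong (suc n) P⇔Q = begin
      count P? (suc n)      ≡⟨ count-suc P? n ⟩
      ⟦ P? n ⟧ + count P? n ≡⟨ cong₂ _+_ (⟦⟧-cong (P⇔Q n ≤-refl) (P? n) (Q? n))
                                         (count-cong n (λ i i<n → P⇔Q i (m≤n⇒m≤1+n i<n))) ⟩
      ⟦ Q? n ⟧ + count Q? n ≡⟨ count-suc Q? n ⟨
      count Q? (suc n)      ∎
      where open ≡-Reasoning

    count-split : ∀ n → count P? n ≡ count (P? ∩? Q?) n + count (P? ∩? ∁? Q?) n
    count-split zero = refl
    count-split (suc n) = begin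
      count P? (suc n)                   ≡⟨ count-suc P? n ⟩
      ⟦ P? n ⟧ + count P? n              ≡⟨ cong (⟦ P? n ⟧ +_) (count-split n) ⟩
      ⟦ P? n ⟧ + (count PQ? n + count P¬Q? n)
        ≡⟨ split-⟦⟧ (count PQ? n) (count P¬Q? n) ⟩
      (⟦ PQ? n ⟧ + count PQ? n) + (⟦ P¬Q? n ⟧ + count P¬Q? n)
        ≡⟨ cong₂ _+_ (count-suc PQ? n) (count-suc P¬Q? n) ⟨
      count PQ? (suc n) + count P¬Q? (suc n) ∎
      where
      open ≡-Reasoning
      PQ? = P? ∩? Q?
      P¬Q? = P? ∩? ∁? Q?
      split-⟦⟧ : ∀ a b → ⟦ P? n ⟧ + (a + b) ≡ (⟦ PQ? n ⟧ + a) + (⟦ P¬Q? n ⟧ + b)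
      split-⟦⟧ a b with P? n | Q? n
      ... | no _  | _     = refl
      ... | yes _ | yes _ = refl
      ... | yes _ | no _  = sym (+-suc a b)

    count-injection : ∀ n (h : ℕ → ℕ) → (∀ i → i < n → P i → h i < n × Q (h i)) →
                      (∀ i j → i < n → j < n → P i → P j → h i ≡ h j → i ≡ j) → count P? n ≤ count Q? n
    count-injection n h maps-into injective = subst (_≤ count Q? n) (length-map h (select P? n))
      (unique-⊆⇒length≤ (map⁺-injectiveOn h (select-unique P? n) injectiveOnSelect) image⊆select)
      where
      injectiveOnSelect : ∀ {i j} → i ∈ select P? n → j ∈ select P? n → h i ≡ h j → i ≡ j
      injectiveOnSelect i∈ j∈ =
        let i<n , Pi = ∈-select⁻ P? i∈ ; j<n , Pj = ∈-select⁻ P? j∈ in injective _ _ i<n j<n Pi Pj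
      image⊆select : map h (select P? n) ⊆ select Q? n
      image⊆select y∈image with i , i∈ , refl ← ∈-map⁻ h y∈image =
        let i<n , Pi = ∈-select⁻ P? i∈ ; hi<n , Qhi = maps-into i i<n Pi in ∈-select⁺ Q? hi<n Qhi

module _ {P Q : ℕ → Set} (P? : Decidable P) (Q? : Decidable Q) where

  count-bijection : ∀ n (h : ℕ → ℕ) → (∀ i → i < n → h i < n) → (∀ i → i < n → P i ⇔ Q (h i)) →
                    (∀ i j → i < n → j < n → h i ≡ h j → i ≡ j) → count P? n ≡ count Q? n
  count-bijection n h h<n P⇔Qh injective = ≤-antisym P≤Q Q≤P
    where
    P≤Q : count P? n ≤ count Q? n
    P≤Q = count-injection P? Q? n h (λ i i<n Pi → h<n i i<n , Equivalence.to (P⇔Qh i i<n) Pi)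
                                    (λ i j i<n j<n _ _ → injective i j i<n j<n)
    ∁P≤∁Q : count (∁? P?) n ≤ count (∁? Q?) n
    ∁P≤∁Q = count-injection (∁? P?) (∁? Q?) n h
      (λ i i<n ¬Pi → h<n i i<n , λ Qhi → ¬Pi (Equivalence.from (P⇔Qh i i<n) Qhi))
      (λ i j i<n j<n _ _ → injective i j i<n j<n)
    Q≤P : count Q? n ≤ count P? n
    Q≤P = +-cancelʳ-≤ (count (∁? P?) n) (count Q? n) (count P? n) (begin
      count Q? n + count (∁? P?) n ≤⟨ +-monoʳ-≤ (count Q? n) ∁P≤∁Q ⟩
      count Q? n + count (∁? Q?) n ≡⟨ count-complement Q? n ⟩
      n                            ≡⟨ count-complement P? n ⟨
      count P? n + count (∁? P?) n ∎)
      where open ≤-Reasoning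

module _ {P : ℕ → Set} (P? : Decidable P) where

  count-periodic : ∀ M k → (∀ i → P (M + i) ⇔ P i) → count P? (k * M) ≡ k * count P? M
  count-periodic M zero    _        = refl
  count-periodic M (suc k) periodic = begin
    count P? (M + k * M)                            ≡⟨ count-+ P? M (k * M) ⟩
    count P? M + count (P? ∘ (M +_)) (k * M)        ≡⟨ cong (count P? M +_)
                                                          (count-cong (P? ∘ (M +_)) P? (k * M) (λ i _ → periodic i)) ⟩
    count P? M + count P? (k * M)                   ≡⟨ cong (count P? M +_) (count-periodic M k periodic) ⟩
    count P? M + k * count P? M                     ∎
    where open ≡-Reasoning

  count-front : ∀ n → count P? (suc n) ≡ ⟦ P? 0 ⟧ + count (P? ∘ suc) n
  count-front n = trans (count-+ P? 1 n)
                        (cong (_+ count (P? ∘ suc) n) (trans (count-suc P? 0) (+-identityʳ ⟦ P? 0 ⟧)))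

  count-shift : ∀ n → (P 0 ⇔ P n) → count (P? ∘ suc) n ≡ count P? n
  count-shift n P0⇔Pn = +-cancelˡ-≡ ⟦ P? n ⟧ _ _ (begin
    ⟦ P? n ⟧ + count (P? ∘ suc) n ≡⟨ cong (_+ count (P? ∘ suc) n) (⟦⟧-cong P0⇔Pn (P? 0) (P? n)) ⟨
    ⟦ P? 0 ⟧ + count (P? ∘ suc) n ≡⟨ count-front n ⟨
    count P? (suc n)              ≡⟨ count-suc P? n ⟩
    ⟦ P? n ⟧ + count P? n         ∎)
    where open ≡-Reasoning

count-blocks : ∀ {A B G : ℕ → Set} (A? : Decidable A) (B? : Decidable B) (G? : Decidable G) a k →
               (∀ j i → i < a → G (i + j * a) ⇔ (B j × A i)) → count G? (k * a) ≡ count B? k * count A? a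
count-blocks A? B? G? a zero    _      = refl
count-blocks {A} {B} {G} A? B? G? a (suc k) G⇔B×A = begin
  count G? (a + k * a)                                    ≡⟨ count-+ G? a (k * a) ⟩
  count G? a + count (G? ∘ (a +_)) (k * a)                ≡⟨ cong₂ _+_ first-block other-blocks ⟩
  ⟦ B? 0 ⟧ * count A? a + count (B? ∘ suc) k * count A? a ≡⟨ *-distribʳ-+ (count A? a) ⟦ B? 0 ⟧ _ ⟨
  (⟦ B? 0 ⟧ + count (B? ∘ suc) k) * count A? a            ≡⟨ cong (_* count A? a) (count-front B? k) ⟨
  count B? (suc k) * count A? a                           ∎
  where
  open ≡-Reasoning
  G⇔B₀×A : ∀ i → i < a → G i ⇔ (B 0 × A i)
  G⇔B₀×A i i<a = subst (λ m → G m ⇔ (B 0 × A i)) (+-identityʳ i) (G⇔B×A 0 i i<a)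
  first-block : count G? a ≡ ⟦ B? 0 ⟧ * count A? a
  first-block with B? 0
  ... | yes B₀ = trans (count-cong G? A? a (λ i i<a → mk⇔ (proj₂ ∘ Equivalence.to (G⇔B₀×A i i<a))
                                                          (λ Ai → Equivalence.from (G⇔B₀×A i i<a) (B₀ , Ai))))
                       (sym (+-identityʳ _))
  ... | no ¬B₀ = count-none G? a (λ i i<a Gi → ¬B₀ (proj₁ (Equivalence.to (G⇔B₀×A i i<a) Gi)))
  other-blocks : count (G? ∘ (a +_)) (k * a) ≡ count (B? ∘ suc) k * count A? a
  other-blocks = count-blocks A? (B? ∘ suc) (G? ∘ (a +_)) a k λ j i i<a →
    subst (λ m → G m ⇔ (B (suc j) × A i)) (x+[y+z]≡y+[x+z] i a (j * a)) (G⇔B×A (suc j) i i<a)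
    where
    x+[y+z]≡y+[x+z] : ∀ x y z → x + (y + z) ≡ y + (x + z)
    x+[y+z]≡y+[x+z] = solve-∀

count-multiples : ∀ p .{{_ : NonZero p}} k → count (p ∣?_) (p * k) ≡ k
count-multiples p@(suc p-1) k = begin
  count (p ∣?_) (p * k) ≡⟨ cong (count (p ∣?_)) (*-comm p k) ⟩
  count (p ∣?_) (k * p) ≡⟨ count-periodic (p ∣?_) p k
                             (λ i → mk⇔ (λ p∣p+i → ∣m+n∣m⇒∣n p∣p+i ∣-refl) (∣m∣n⇒∣m+n ∣-refl)) ⟩
  k * count (p ∣?_) p   ≡⟨ cong (k *_) one-multiple ⟩
  k * 1                 ≡⟨ *-identityʳ k ⟩
  k                     ∎
  where
  open ≡-Reasoning
  one-multiple : count (p ∣?_) p ≡ 1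
  one-multiple = begin
    count (p ∣?_) p                          ≡⟨ count-front (p ∣?_) p-1 ⟩
    ⟦ p ∣? 0 ⟧ + count ((p ∣?_) ∘ suc) p-1   ≡⟨ cong₂ _+_ (⟦⟧-yes (p ∣? 0) (p ∣0))
                                                 (count-none ((p ∣?_) ∘ suc) p-1
                                                    (λ i i<p-1 p∣1+i → <⇒≱ (s≤s i<p-1) (∣⇒≤ p∣1+i))) ⟩
    1                                        ∎

length-filter-map : ∀ {A B : Set} {P : B → Set} (P? : Decidable P) (f : A → B) xs →
                    length (filter P? (map f xs)) ≡ length (filter (P? ∘ f) xs)
length-filter-map P? f []       = refl
length-filter-map P? f (x ∷ xs) with does (P? (f x))
... | true  = cong suc (length-filter-map P? f xs)
... | false = length-filter-map P? f xs

map-toℕ-allFin : ∀ n → map toℕ (allFin n) ≡ upTo n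
map-toℕ-allFin zero    = refl
map-toℕ-allFin (suc n) = cong (0 ∷_) (begin
  map toℕ (tabulate fsuc)          ≡⟨ map-tabulate fsuc toℕ ⟩
  tabulate (suc ∘ toℕ)             ≡⟨ map-tabulate id (suc ∘ toℕ) ⟨
  map (suc ∘ toℕ) (allFin n)       ≡⟨ map-∘ (allFin n) ⟩
  map suc (map toℕ (allFin n))     ≡⟨ cong (map suc) (map-toℕ-allFin n) ⟩
  map suc (upTo n)                 ≡⟨ map-upTo suc n ⟩
  applyUpTo suc n                  ∎)
  where open ≡-Reasoning

-- Euler's totient function

coprimeTo? : ∀ n → Decidable (λ k → Coprime k n)
coprimeTo? n k = coprime? k n

-- Defs.totient inspects 1, …, n while count inspects 0, …, n - 1; 0 and n are coprime to n together.
totient≡count : ∀ n → totient n ≡ count (coprimeTo? n) n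
totient≡count n = trans (length-filter-map (coprimeTo? n) suc (upTo n))
  (count-shift (coprimeTo? n) n (mk⇔ (λ 0⊥n {_} (d∣n , _) → 0⊥n (_ ∣0 , d∣n))
                                     (λ n⊥n {_} (_ , d∣n) → n⊥n (d∣n , d∣n))))

product-coprime : ∀ {n} (L : List ℕ) → (∀ {u} → u ∈ L → Coprime u n) → Coprime (product L) n
product-coprime {n} []      _     = 1-coprimeTo n
product-coprime     (u ∷ L) all⊥n = coprime-*ˡ (all⊥n (here refl)) (product-coprime L (all⊥n ∘ there))

product-map-mod : ∀ {n x} (g : ℕ → ℕ) → (∀ u → g u ≡ x * u mod n) →
                  ∀ L → product (map g L) ≡ x ^ length L * product L mod n
product-map-mod g g≡x* []      = mod-refl
product-map-mod {n} {x} g g≡x* (u ∷ L) = begin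
  g u * product (map g L)               ≈⟨ *-cong-mod (g≡x* u) (product-map-mod g g≡x* L) ⟩
  (x * u) * (x ^ length L * product L)  ≡⟨ *-interchange x u _ _ ⟩
  (x * x ^ length L) * (u * product L)  ∎
  where open ≡-mod-Reasoning n

module _ {n : ℕ} .{{_ : NonZero n}} {x : ℕ} (x⊥n : Coprime x n) where

  private
    units = select (coprimeTo? n) n

    multiplyBy-x : ℕ → ℕ
    multiplyBy-x u = (x * u) % n

    multiplyBy-x-injective : ∀ {u v} → u ∈ units → v ∈ units → multiplyBy-x u ≡ multiplyBy-x v → u ≡ v
    multiplyBy-x-injective u∈ v∈ xu≡xv =
      <∧≡-mod⇒≡ (proj₁ (∈-select⁻ (coprimeTo? n) {n} u∈)) (proj₁ (∈-select⁻ (coprimeTo? n) {n} v∈))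
      (mod-cancelˡ (coprime-sym x⊥n) (%≡⇒≡-mod xu≡xv))

    multiplyBy-x-units : map multiplyBy-x units ⊆ units
    multiplyBy-x-units y∈ with u , u∈ , refl ← ∈-map⁻ multiplyBy-x y∈ =
      ∈-select⁺ (coprimeTo? n) (m%n<n (x * u) n)
                (coprime-% (coprime-*ˡ x⊥n (proj₂ (∈-select⁻ (coprimeTo? n) {n} u∈))))

    multiplyBy-x-permutes : map multiplyBy-x units ↭ units
    multiplyBy-x-permutes = unique-⊆∧length≤⇒↭
      (map⁺-injectiveOn multiplyBy-x (select-unique (coprimeTo? n) n) multiplyBy-x-injective)
      multiplyBy-x-units (≤-reflexive (sym (length-map multiplyBy-x units)))

  euler : x ^ totient n ≡ 1 mod n
  euler = mod-cancelˡ (coprime-sym ∏units⊥n) (begin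
    product units * x ^ totient n          ≡⟨ cong (λ k → product units * x ^ k) (totient≡count n) ⟩
    product units * x ^ length units       ≡⟨ *-comm (product units) _ ⟩
    x ^ length units * product units       ≈⟨ product-map-mod multiplyBy-x (λ u → m%n≡m-mod (x * u)) units ⟨
    product (map multiplyBy-x units)       ≡⟨ product-↭ multiplyBy-x-permutes ⟩
    product units                          ≡⟨ *-identityʳ (product units) ⟨
    product units * 1                      ∎)
    where
    open ≡-mod-Reasoning n
    ∏units⊥n : Coprime (product units) n
    ∏units⊥n = product-coprime units (proj₂ ∘ ∈-select⁻ (coprimeTo? n) {n})

totient≡#non-multiples : ∀ {p} r → Prime p → totient (p ^ suc r) ≡ count (∁? (p ∣?_)) (p ^ suc r)
totient≡#non-multiples {p} r p-prime = trans (totient≡count (p ^ suc r))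
  (count-cong (coprimeTo? (p ^ suc r)) (∁? (p ∣?_)) (p ^ suc r) λ i _ →
  mk⇔ (λ (i⊥N : Coprime i (p ^ suc r)) p∣i → coprime⇒¬prime∣ (coprime-sym i⊥N) p-prime (m∣m*n (p ^ r)) p∣i)
      (λ p∤i → coprime-sym (prime∤⇒coprime-^ (suc r) p-prime p∤i)))

totient-prime-power : ∀ {p} r → Prime p → totient (p ^ suc r) + p ^ r ≡ p ^ suc r
totient-prime-power {p} r p-prime = begin
  totient N + p ^ r                          ≡⟨ cong₂ _+_ (sym (totient≡#non-multiples r p-prime)) #multiples ⟨
  count (∁? (p ∣?_)) N + count (p ∣?_) N     ≡⟨ +-comm (count (∁? (p ∣?_)) N) _ ⟩
  count (p ∣?_) N + count (∁? (p ∣?_)) N     ≡⟨ count-complement (p ∣?_) N ⟩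
  N                                          ∎
  where
  open ≡-Reasoning
  instance _ = prime⇒nonZero p-prime
  N = p ^ suc r
  #multiples : count (p ∣?_) N ≡ p ^ r
  #multiples = count-multiples p (p ^ r)

totient-prime : ∀ {p} → Prime p → totient p + 1 ≡ p
totient-prime {p} p-prime = subst (λ q → totient q + 1 ≡ q) (*-identityʳ p) (totient-prime-power 0 p-prime)

module _ (a : ℕ) .{{_ : NonZero a}} where

  [i+ja]%a≡i : ∀ i j → i < a → (i + j * a) % a ≡ i
  [i+ja]%a≡i i j i<a = trans ([m+kn]%n≡m%n i j a) (m<n⇒m%n≡m i<a)

  [i+ja]/a≡j : ∀ i j → i < a → (i + j * a) / a ≡ j
  [i+ja]/a≡j i j i<a = trans (+-distrib-/-∣ʳ i (divides j refl)) (cong₂ _+_ (m<n⇒m/n≡0 i<a) (m*n/n≡m j a))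

  i+ja<ab : ∀ b {i j} → i < a → j < b → i + j * a < a * b
  i+ja<ab b {i} {j} i<a j<b = begin-strict
    i + j * a <⟨ +-monoˡ-< (j * a) i<a ⟩
    suc j * a ≤⟨ *-monoˡ-≤ a j<b ⟩
    b * a     ≡⟨ *-comm b a ⟩
    a * b     ∎
    where open ≤-Reasoning

-- x ↦ x % a + (x % b) * a permutes [0, ab) (Chinese remainder theorem) and turns the units modulo
-- ab into the pairs (unit modulo a, unit modulo b), laid out in b blocks of length a.
totient-* : ∀ a b .{{_ : NonZero a}} .{{_ : NonZero b}} → Coprime a b → totient (a * b) ≡ totient a * totient b
totient-* a b a⊥b = begin
  totient (a * b)                                  ≡⟨ totient≡count (a * b) ⟩
  count (coprimeTo? (a * b)) (a * b)               ≡⟨ count-bijection (coprimeTo? (a * b)) G? (a * b) encode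
                                                        (λ x _ → i+ja<ab a b (m%n<n x a) (m%n<n x b))
                                                        (λ x _ → mk⇔ (coprime⇒G x) (G⇒coprime x)) encode-injective ⟩
  count G? (a * b)                                 ≡⟨ cong (count G?) (*-comm a b) ⟩
  count G? (b * a)                                 ≡⟨ count-blocks (coprimeTo? a) (coprimeTo? b) G? a b G-blocks ⟩
  count (coprimeTo? b) b * count (coprimeTo? a) a  ≡⟨ cong₂ _*_ (totient≡count b) (totient≡count a) ⟨
  totient b * totient a                            ≡⟨ *-comm (totient b) (totient a) ⟩
  totient a * totient b                            ∎
  where
  open ≡-Reasoning
  instance _ = m*n≢0 a b
  G : ℕ → Set
  G y = Coprime (y / a) b × Coprime (y % a) a
  G? : Decidable G
  G? y = coprime? (y / a) b ×-dec coprime? (y % a) a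
  G-blocks : ∀ j i → i < a → G (i + j * a) ⇔ (Coprime j b × Coprime i a)
  G-blocks j i i<a = subst₂ (λ u v → (Coprime u b × Coprime v a) ⇔ (Coprime j b × Coprime i a))
    (sym ([i+ja]/a≡j a i j i<a)) (sym ([i+ja]%a≡i a i j i<a)) (mk⇔ id id)
  encode : ℕ → ℕ
  encode x = x % a + (x % b) * a
  encode%a : ∀ x → encode x % a ≡ x % a
  encode%a x = [i+ja]%a≡i a (x % a) (x % b) (m%n<n x a)
  encode/a : ∀ x → encode x / a ≡ x % b
  encode/a x = [i+ja]/a≡j a (x % a) (x % b) (m%n<n x a)
  coprime⇒G : ∀ x → Coprime x (a * b) → G (encode x)
  coprime⇒G x x⊥ab = let x⊥a , x⊥b = Equivalence.to coprime-*ʳ⇔ x⊥ab in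
    subst (λ u → Coprime u b) (sym (encode/a x)) (coprime-% x⊥b) ,
    subst (λ v → Coprime v a) (sym (encode%a x)) (coprime-% x⊥a)
  G⇒coprime : ∀ x → G (encode x) → Coprime x (a * b)
  G⇒coprime x (ex/a⊥b , ex%a⊥a) = Equivalence.from coprime-*ʳ⇔
    ( Equivalence.to coprime-%ˡ⇔ (subst (λ v → Coprime v a) (encode%a x) ex%a⊥a)
    , Equivalence.to coprime-%ˡ⇔ (subst (λ u → Coprime u b) (encode/a x) ex/a⊥b))
  encode-injective : ∀ x y → x < a * b → y < a * b → encode x ≡ encode y → x ≡ y
  encode-injective x y x<ab y<ab ex≡ey = <∧≡-mod⇒≡ x<ab y<ab (chinese-remainder a⊥b
    (%≡⇒≡-mod (trans (sym (encode%a x)) (trans (cong (_% a) ex≡ey) (encode%a y))))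
    (%≡⇒≡-mod (trans (sym (encode/a x)) (trans (cong (_/ a) ex≡ey) (encode/a y)))))

-- y = c - 1 has y² ≡ 1, so an odd φ(c) would give y ≡ y^φ(c) ≡ 1 (mod c).
totient-even : ∀ c → 2 < c → ∃[ u ] totient c ≡ u + u
totient-even c@(suc y@(suc (suc c-3))) (s≤s (s≤s (s≤s z≤n))) with even⊎odd (totient c)
... | u , inj₁ φ≡u+u   = u , φ≡u+u
... | u , inj₂ φ≡1+u+u = ⊥-elim (y≢1 (<∧≡-mod⇒≡ ≤-refl (s≤s (s≤s z≤n)) y≡1))
  where
  open ≡-mod-Reasoning c
  y≢1 : y ≢ 1
  y≢1 ()
  y²≡1 : y * y ≡ 1 mod c
  y²≡1 = mod-trans (mod-reflexive (y*y≡1+[1+c-3]*c c-3)) (m+kn≡m-mod 1 (suc c-3))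
    where
    y*y≡1+[1+c-3]*c : ∀ m → (2 + m) * (2 + m) ≡ 1 + (1 + m) * (3 + m)
    y*y≡1+[1+c-3]*c = solve-∀
  y⊥c : Coprime y c
  y⊥c = coprime-sym (subst (λ m → Coprime m y) (+-comm y 1) (coprime-+ (1-coprimeTo y)))
  y≡1 : y ≡ 1 mod c
  y≡1 = begin
    y                 ≡⟨ *-identityʳ y ⟨
    y * 1             ≈⟨ *-cong-mod (mod-refl {c} {y}) (^-≡1-mod u y²≡1) ⟨
    y * (y * y) ^ u   ≡⟨ cong (y *_) (trans (^-distribʳ-* y y u) (sym (^-distribˡ-+-* y u u))) ⟩
    y ^ suc (u + u)   ≡⟨ cong (y ^_) φ≡1+u+u ⟨
    y ^ totient c     ≈⟨ euler y⊥c ⟩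
    1                 ∎

fermat : ∀ {p y} → Prime p → ¬ p ∣ y → y ^ p ≡ y mod p
fermat {p} {y} p-prime p∤y = begin
  y ^ p                ≡⟨ cong (y ^_) (trans (sym (totient-prime p-prime)) (+-comm (totient p) 1)) ⟩
  y * y ^ totient p    ≈⟨ *-cong-mod (mod-refl {p} {y}) (euler (coprime-sym (prime∤⇒coprime p-prime p∤y))) ⟩
  y * 1                ≡⟨ *-identityʳ y ⟩
  y                    ∎
  where
  open ≡-mod-Reasoning p
  instance _ = prime⇒nonZero p-prime

frobenius : ∀ {p y} j → Prime p → ¬ p ∣ y → y ^ (p ^ j) ≡ y mod p
frobenius {y = y} zero    _       _   = mod-reflexive (*-identityʳ y)
frobenius {p} {y} (suc j) p-prime p∤y = begin
  y ^ (p * p ^ j)      ≡⟨ ^-*-assoc y p (p ^ j) ⟨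
  (y ^ p) ^ (p ^ j)    ≈⟨ ^-cong-mod (p ^ j) (fermat p-prime p∤y) ⟩
  y ^ (p ^ j)          ≈⟨ frobenius j p-prime p∤y ⟩
  y                    ∎
  where open ≡-mod-Reasoning p

-- Roots of polynomials modulo a prime

Polynomial : Set
Polynomial = List ℕ

eval : Polynomial → ℕ → ℕ
eval []       x = 0
eval (c ∷ cs) x = c + x * eval cs x

syntheticDivision : Polynomial → ℕ → Polynomial
syntheticDivision []            r = []
syntheticDivision (c ∷ [])      r = []
syntheticDivision (c ∷ c′ ∷ cs) r = eval (c′ ∷ cs) r ∷ syntheticDivision (c′ ∷ cs) r

length-syntheticDivision : ∀ c cs r → length (syntheticDivision (c ∷ cs) r) ≡ length cs
length-syntheticDivision c []        r = refl
length-syntheticDivision c (c′ ∷ cs) r = cong suc (length-syntheticDivision c′ cs r)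

-- f(x) - f(r) = (x - r) q(x), with both sides moved so that no subtraction occurs.
eval-syntheticDivision : ∀ f x r →
  eval f x + r * eval (syntheticDivision f r) x ≡ eval f r + x * eval (syntheticDivision f r) x
eval-syntheticDivision []            x r = trans (*-zeroʳ r) (sym (*-zeroʳ x))
eval-syntheticDivision (c ∷ [])      x r = constant c x r
  where
  constant : ∀ c x r → (c + x * 0) + r * 0 ≡ (c + r * 0) + x * 0
  constant = solve-∀
eval-syntheticDivision (c ∷ c′ ∷ cs) x r = begin
  (c + x * A) + r * (B + x * Q) ≡⟨ regroup c x A r B Q ⟩
  c + r * B + x * (A + r * Q)   ≡⟨ cong (λ z → c + r * B + x * z) (eval-syntheticDivision (c′ ∷ cs) x r) ⟩
  c + r * B + x * (B + x * Q)   ∎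
  where
  open ≡-Reasoning
  A = eval (c′ ∷ cs) x
  B = eval (c′ ∷ cs) r
  Q = eval (syntheticDivision (c′ ∷ cs) r) x
  regroup : ∀ c x A r B Q → (c + x * A) + r * (B + x * Q) ≡ c + r * B + x * (A + r * Q)
  regroup = solve-∀

module _ {p : ℕ} where
  open import Data.List.Relation.Unary.All using ([]; _∷_)
  open import Data.List.Relation.Unary.AllPairs using ([]; _∷_)

  syntheticDivision-≡0 : ∀ f r → eval f r ≡ 0 mod p →
                         All (λ c → c ≡ 0 mod p) (syntheticDivision f r) → All (λ c → c ≡ 0 mod p) f
  syntheticDivision-≡0 []            r _    _          = []
  syntheticDivision-≡0 (c ∷ [])      r f[r] _          = mod-trans (mod-reflexive (sym (m+n*0≡m c r))) f[r] ∷ []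
  syntheticDivision-≡0 (c ∷ c′ ∷ cs) r f[r] (q₀ ∷ qs) = c≡0 ∷ syntheticDivision-≡0 (c′ ∷ cs) r q₀ qs
    where
    c≡0 : c ≡ 0 mod p
    c≡0 = begin
      c                          ≡⟨ m+n*0≡m c r ⟨
      c + r * 0                  ≈⟨ +-cong-mod (mod-refl {p} {c}) (*-cong-mod (mod-refl {p} {r}) q₀) ⟨
      c + r * eval (c′ ∷ cs) r   ≈⟨ f[r] ⟩
      0                          ∎
      where open ≡-mod-Reasoning p

  lagrange : Prime p → ∀ f rs → Unique rs → (∀ {r} → r ∈ rs → r < p) → length f ≤ length rs →
             (∀ {r} → r ∈ rs → eval f r ≡ 0 mod p) → All (λ c → c ≡ 0 mod p) f
  lagrange p-prime []       rs       _            _    _         _     = []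
  lagrange p-prime (c ∷ cs) (r ∷ rs) (r∉rs ∷ rs!) rs<p (s≤s len) roots =
    syntheticDivision-≡0 (c ∷ cs) r (roots (here refl))
      (lagrange p-prime q rs rs! (rs<p ∘ there)
                (subst (_≤ length rs) (sym (length-syntheticDivision c cs r)) len) q-roots)
    where
    instance _ = prime⇒nonZero p-prime
    q = syntheticDivision (c ∷ cs) r
    q-roots : ∀ {s} → s ∈ rs → eval q s ≡ 0 mod p
    q-roots {s} s∈rs with p ∣? eval q s
    ... | yes p∣q[s] = ∣⇒≡0-mod p∣q[s]
    ... | no  p∤q[s] = ⊥-elim (All.lookup r∉rs s∈rs (<∧≡-mod⇒≡ (rs<p (here refl)) (rs<p (there s∈rs))
                         (mod-cancelˡ (prime∤⇒coprime p-prime p∤q[s]) q[s]*r≡q[s]*s)))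
      where
      open ≡-mod-Reasoning p
      q[s]*r≡q[s]*s : eval q s * r ≡ eval q s * s mod p
      q[s]*r≡q[s]*s = begin
        eval q s * r                               ≡⟨ *-comm (eval q s) r ⟩
        r * eval q s                               ≈⟨ +-cong-mod (roots (there s∈rs)) (mod-refl {p} {r * eval q s}) ⟨
        eval (c ∷ cs) s + r * eval q s             ≡⟨ eval-syntheticDivision (c ∷ cs) s r ⟩
        eval (c ∷ cs) r + s * eval q s             ≈⟨ +-cong-mod (roots (here refl)) (mod-refl {p} {s * eval q s}) ⟩
        s * eval q s                               ≡⟨ *-comm s (eval q s) ⟩
        eval q s * s                               ∎

monomial : ℕ → Polynomial
monomial zero    = [ 1 ]
monomial (suc k) = 0 ∷ monomial k

eval-monomial : ∀ k x → eval (monomial k) x ≡ x ^ k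
eval-monomial zero    x = m+n*0≡m 1 x
eval-monomial (suc k) x = cong (x *_) (eval-monomial k x)

length-monomial : ∀ k → length (monomial k) ≡ suc k
length-monomial zero    = refl
length-monomial (suc k) = cong suc (length-monomial k)

monomial-≢0 : ∀ {p} k → 1 < p → ¬ All (λ c → c ≡ 0 mod p) (monomial k)
monomial-≢0 zero    1<p (1≡0 All.∷ _) = <⇒≱ 1<p (∣⇒≤ (≡0-mod⇒∣ 1≡0))
monomial-≢0 (suc k) 1<p (_ All.∷ cs≡0) = monomial-≢0 k 1<p cs≡0

-- (p ∸ 1) ∷ monomial m is x^(m+1) - 1 with -1 written as p - 1: it has m + 2 ≤ p - 1 coefficients,
-- so it cannot vanish at all p - 1 units.
units-not-all-roots : ∀ {p} m → Prime p → suc m + 2 ≤ p →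
                      ¬ (∀ (i : Fin p) → Coprime (toℕ i) p → toℕ i ^ suc m ≡ 1 mod p)
units-not-all-roots {p} m p-prime [1+m]+2≤p all-roots =
  monomial-≢0 m (prime>1 p-prime) (All.tail (lagrange p-prime f units (select-unique (coprimeTo? p) p)
    (proj₁ ∘ ∈-select⁻ (coprimeTo? p) {p}) f≤units roots))
  where
  f = (p ∸ 1) ∷ monomial m
  units = select (coprimeTo? p) p
  roots : ∀ {u} → u ∈ units → eval f u ≡ 0 mod p
  roots {u} u∈units = let u<p , u⊥p = ∈-select⁻ (coprimeTo? p) {p} u∈units in begin
    p ∸ 1 + u * eval (monomial m) u ≡⟨ cong (λ v → p ∸ 1 + u * v) (eval-monomial m u) ⟩
    p ∸ 1 + u ^ suc m               ≈⟨ +-cong-mod (mod-refl {p} {p ∸ 1})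
                                         (subst (λ v → v ^ suc m ≡ 1 mod p) (toℕ-fromℕ< u<p) (all-roots (fromℕ< u<p)
                                           (subst (λ v → Coprime v p) (sym (toℕ-fromℕ< u<p)) u⊥p))) ⟩
    p ∸ 1 + 1                       ≡⟨ m∸n+n≡m (<⇒≤ (prime>1 p-prime)) ⟩
    p                               ≈⟨ n≡0-mod ⟩
    0                               ∎
    where open ≡-mod-Reasoning p
  f≤units : length f ≤ length units
  f≤units = +-cancelʳ-≤ 1 _ _ (begin
    length f + 1         ≡⟨ cong (λ k → suc k + 1) (length-monomial m) ⟩
    suc (suc m) + 1      ≡⟨ cong suc (+-suc m 1) ⟨
    suc m + 2            ≤⟨ [1+m]+2≤p ⟩
    p                    ≡⟨ totient-prime p-prime ⟨
    totient p + 1        ≡⟨ cong (_+ 1) (totient≡count p) ⟩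
    length units + 1     ∎)
    where open ≤-Reasoning

∃non-root : ∀ {p} d → Prime p → 0 < d → d + 2 ≤ p → ∃[ a ] ¬ p ∣ a × ¬ a ^ d ≡ 1 mod p
∃non-root {p} d@(suc m) p-prime _ d+2≤p =
  let i , non-root = ¬∀⟶∃¬ p Root root? (units-not-all-roots m p-prime d+2≤p)
  in toℕ i , coprime⇒¬prime∣ (coprime-sym (unit i non-root)) p-prime ∣-refl , λ root → non-root (λ _ → root)
  where
  instance _ = prime⇒nonZero p-prime
  Root : Fin p → Set
  Root i = Coprime (toℕ i) p → toℕ i ^ suc m ≡ 1 mod p
  root? : ∀ i → Dec (Root i)
  root? i = coprime? (toℕ i) p →-dec (toℕ i ^ suc m ≡? 1 mod p)
  unit : ∀ i → ¬ Root i → Coprime (toℕ i) p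
  unit i non-root with coprime? (toℕ i) p
  ... | yes i⊥p = i⊥p
  ... | no  i⊥̸p = ⊥-elim (non-root (λ i⊥p → ⊥-elim (i⊥̸p i⊥p)))

-- Counted residues

IsPowerPeriod : ℕ → ℕ → ℕ → Set
IsPowerPeriod n H x = ∃[ k ] 1 ≤ k × x ^ (k + H) ≡ x ^ k mod n

IsCounted⇔IsPowerPeriod : ∀ n .{{_ : NonZero n}} {H} → ⌈ totient n /2⌉ ≡ H →
                          ∀ x → IsCounted n x ⇔ IsPowerPeriod n H (toℕ x)
IsCounted⇔IsPowerPeriod n refl x =
  mk⇔ (λ (k , k≥1 , e) → k , k≥1 , %≡⇒≡-mod e) (λ (k , k≥1 , e) → k , k≥1 , ≡-mod⇒%≡ e)

count⇒MEquals : ∀ n .{{_ : NonZero n}} {P : ℕ → Set} (P? : Decidable P) {v} →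
                (∀ x → IsCounted n x ⇔ P (toℕ x)) → count P? n ≡ v → MEquals n v
count⇒MEquals n P? {v} counted⇔P count≡v =
  L , filter⁺ (P? ∘ toℕ) (allFin⁺ n) ,
  (λ x → mk⇔ (λ x∈L → Equivalence.from (counted⇔P x) (proj₂ (∈-filter⁻ (P? ∘ toℕ) {xs = allFin n} x∈L)))
             (λ counted → ∈-filter⁺ (P? ∘ toℕ) (∈-allFin x) (Equivalence.to (counted⇔P x) counted))) ,
  (begin
    length L                                  ≡⟨ length-filter-map P? toℕ (allFin n) ⟨
    length (filter P? (map toℕ (allFin n)))   ≡⟨ cong (length ∘ filter P?) (map-toℕ-allFin n) ⟩
    count P? n                                ≡⟨ count≡v ⟩
    v                                         ∎)
  where
  open ≡-Reasoning
  L = filter (P? ∘ toℕ) (allFin n)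

-- Odd prime powers and their doubles

module OddPrimePowerModulus {p t : ℕ} (p-prime : Prime p) (p≡1+2t : p ≡ suc (t + t)) (r : ℕ) where

  N : ℕ
  N = p ^ suc r

  h : ℕ
  h = t * p ^ r

  instance
    p≢0 : NonZero p
    p≢0 = prime⇒nonZero p-prime
    N≢0 : NonZero N
    N≢0 = m^n≢0 p (suc r)
    2N≢0 : NonZero (2 * N)
    2N≢0 = m*n≢0 2 N

  t≥1 : 1 ≤ t
  t≥1 = n≢0⇒n>0 λ t≡0 → ¬prime[1] (subst Prime (trans p≡1+2t (cong (λ s → suc (s + s)) t≡0)) p-prime)

  p≥3 : 3 ≤ p
  p≥3 = subst (3 ≤_) (sym p≡1+2t) (s≤s (+-mono-≤ t≥1 t≥1))

  p≢2 : p ≢ 2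
  p≢2 p≡2 = <-irrefl (sym p≡2) p≥3

  N≥3 : 3 ≤ N
  N≥3 = ≤-trans p≥3 (m≤m*n p (p ^ r) {{m^n≢0 p r}})

  p∣N : p ∣ N
  p∣N = m∣m*n (p ^ r)

  totient-N : totient N ≡ h + h
  totient-N = +-cancelʳ-≡ (p ^ r) _ _ (begin
    totient N + p ^ r           ≡⟨ totient-prime-power r p-prime ⟩
    p * p ^ r                   ≡⟨ cong (_* p ^ r) p≡1+2t ⟩
    suc (t + t) * p ^ r         ≡⟨ expand t (p ^ r) ⟩
    (h + h) + p ^ r             ∎)
    where
    open ≡-Reasoning
    expand : ∀ t q → suc (t + t) * q ≡ (t * q + t * q) + q
    expand = solve-∀

  totient-p : totient p ≡ t + t
  totient-p = +-cancelʳ-≡ 1 (totient p) (t + t) (trans (totient-prime p-prime) (trans p≡1+2t (+-comm 1 (t + t))))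

  ⌈totient-N/2⌉≡h : ⌈ totient N /2⌉ ≡ h
  ⌈totient-N/2⌉≡h = trans (cong ⌈_/2⌉ totient-N) (⌈n+n/2⌉≡n h)

  x^h≡±1 : ∀ {x} → ¬ p ∣ x → x ^ h ≡ 1 mod N ⊎ x ^ h + 1 ≡ 0 mod N
  x^h≡±1 {x} p∤x = square≡1⇒≡±1 (suc r) (x ^ h) p-prime p≢2 (begin
    x ^ h * x ^ h     ≡⟨ ^-distribˡ-+-* x h h ⟨
    x ^ (h + h)       ≡⟨ cong (x ^_) totient-N ⟨
    x ^ totient N     ≈⟨ euler (coprime-sym (prime∤⇒coprime-^ (suc r) p-prime p∤x)) ⟩
    1                 ∎)
    where open ≡-mod-Reasoning N

  t+2≤p : t + 2 ≤ p
  t+2≤p = subst (t + 2 ≤_) (sym p≡1+2t) (subst (_≤ suc (t + t)) (+-comm 2 t) (s≤s (+-monoˡ-≤ t t≥1)))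

  mod-p⇒mod-p¹ : ∀ {x y} → x ≡ y mod p → x ≡ y mod p ^ 1
  mod-p⇒mod-p¹ = subst (λ m → _ ≡ _ mod m) (sym (*-identityʳ p))

  mod-p¹⇒mod-p : ∀ {x y} → x ≡ y mod p ^ 1 → x ≡ y mod p
  mod-p¹⇒mod-p = subst (λ m → _ ≡ _ mod m) (*-identityʳ p)

  aᵗ*aᵗ≡1 : ∀ {a} → ¬ p ∣ a → a ^ t * a ^ t ≡ 1 mod p
  aᵗ*aᵗ≡1 {a} p∤a = begin
    a ^ t * a ^ t   ≡⟨ ^-distribˡ-+-* a t t ⟨
    a ^ (t + t)     ≡⟨ cong (a ^_) totient-p ⟨
    a ^ totient p   ≈⟨ euler (coprime-sym (prime∤⇒coprime p-prime p∤a)) ⟩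
    1               ∎
    where open ≡-mod-Reasoning p

  aᵗ≢1⇒aᵗ≡-1 : ∀ {a} → ¬ p ∣ a → ¬ a ^ t ≡ 1 mod p → a ^ t + 1 ≡ 0 mod p
  aᵗ≢1⇒aᵗ≡-1 {a} p∤a aᵗ≢1 =
    [ (λ aᵗ≡1 → ⊥-elim (aᵗ≢1 (mod-p¹⇒mod-p aᵗ≡1))) , mod-p¹⇒mod-p ]′
    (square≡1⇒≡±1 1 (a ^ t) p-prime p≢2 (mod-p⇒mod-p¹ (aᵗ*aᵗ≡1 p∤a)))

  aʰ≡aᵗ : ∀ {a} → ¬ p ∣ a → a ^ h ≡ a ^ t mod p
  aʰ≡aᵗ {a} p∤a = mod-trans (mod-reflexive (sym (^-*-assoc a t (p ^ r))))
                            (frobenius r p-prime (p∤a ∘ prime∣^⇒∣ t p-prime))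

  aᵗ≡-1⇒aʰ≡-1 : ∀ {a} → ¬ p ∣ a → a ^ t + 1 ≡ 0 mod p → a ^ h + 1 ≡ 0 mod N
  aᵗ≡-1⇒aʰ≡-1 {a} p∤a aᵗ≡-1 =
    [ (λ aʰ≡1 → ⊥-elim (1≢-1-mod p≥3 (mod-trans (mod-sym (aʰ≡aᵗ p∤a)) (mod-∣ p∣N aʰ≡1)) aᵗ≡-1)) , id ]′
    (x^h≡±1 p∤a)

  ∃non-residue : ∃[ a ] ¬ p ∣ a × a ^ h + 1 ≡ 0 mod N
  ∃non-residue = let a , p∤a , aᵗ≢1 = ∃non-root t p-prime t≥1 t+2≤p
                 in a , p∤a , aᵗ≡-1⇒aʰ≡-1 p∤a (aᵗ≢1⇒aᵗ≡-1 p∤a aᵗ≢1)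

  a : ℕ
  a = proj₁ ∃non-residue

  p∤a : ¬ p ∣ a
  p∤a = proj₁ (proj₂ ∃non-residue)

  aʰ≡-1 : a ^ h + 1 ≡ 0 mod N
  aʰ≡-1 = proj₂ (proj₂ ∃non-residue)

  Residue : ℕ → Set
  Residue x = x ^ h ≡ 1 mod N

  residue? : Decidable Residue
  residue? x = x ^ h ≡? 1 mod N

  Counted : ℕ → Set
  Counted x = p ∣ x ⊎ Residue x

  counted? : Decidable Counted
  counted? x = p ∣? x ⊎-dec residue? x

  Counted⇒IsPowerPeriod : ∀ {x} → Counted x → IsPowerPeriod N h x
  Counted⇒IsPowerPeriod {x} (inj₁ p∣x)  =
    suc r , s≤s z≤n , ^≡0⇒^+≡^ x (suc r) h (∣⇒≡0-mod (^-monoˡ-∣ (suc r) p∣x))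
  Counted⇒IsPowerPeriod {x} (inj₂ xʰ≡1) =
    1 , s≤s z≤n , ^≡1⇒^+≡^ x 1 h xʰ≡1

  IsPowerPeriod⇒Counted : ∀ {M x} → N ∣ M → IsPowerPeriod M h x → Counted x
  IsPowerPeriod⇒Counted {M} {x} N∣M (k , _ , xᵏ⁺ʰ≡xᵏ) with p ∣? x
  ... | yes p∣x = inj₁ p∣x
  ... | no  p∤x = inj₂ (mod-cancelˡ N⊥xᵏ (begin
    x ^ k * x ^ h   ≡⟨ ^-distribˡ-+-* x k h ⟨
    x ^ (k + h)     ≈⟨ mod-∣ N∣M xᵏ⁺ʰ≡xᵏ ⟩
    x ^ k           ≡⟨ *-identityʳ (x ^ k) ⟨
    x ^ k * 1       ∎))
    where
    open ≡-mod-Reasoning N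
    N⊥xᵏ : Coprime N (x ^ k)
    N⊥xᵏ = coprime-sym (coprime-^ˡ k (coprime-sym (prime∤⇒coprime-^ (suc r) p-prime p∤x)))

  times-a : ℕ → ℕ
  times-a i = (a * i) % N

  times-a-injective : ∀ i j → i < N → j < N → times-a i ≡ times-a j → i ≡ j
  times-a-injective i j i<N j<N ai≡aj = <∧≡-mod⇒≡ i<N j<N
    (mod-cancelˡ (prime∤⇒coprime-^ (suc r) p-prime p∤a) (%≡⇒≡-mod ai≡aj))

  times-a-unit : ∀ {i} → ¬ p ∣ i → ¬ p ∣ times-a i
  times-a-unit {i} p∤i p∣ai%N = [ p∤a , p∤i ]′ (euclidsLemma a i p-prime (∣n∣m%n⇒∣m p∣N p∣ai%N))

  [times-a]ʰ : ∀ i → times-a i ^ h ≡ a ^ h * i ^ h mod N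
  [times-a]ʰ i = mod-trans (^-cong-mod h (m%n≡m-mod (a * i))) (mod-reflexive (^-distribʳ-* a i h))

  #residues : ℕ
  #residues = count (∁? (p ∣?_) ∩? residue?) N

  #non-residues : ℕ
  #non-residues = count (∁? (p ∣?_) ∩? ∁? residue?) N

  #residues≤#non-residues : #residues ≤ #non-residues
  #residues≤#non-residues = count-injection (∁? (p ∣?_) ∩? residue?) (∁? (p ∣?_) ∩? ∁? residue?) N times-a
    (λ i _ (p∤i , iʰ≡1) → m%n<n (a * i) N , times-a-unit p∤i , λ [ai]ʰ≡1 →
       1≢-1-mod N≥3 [ai]ʰ≡1 (mod-trans (+-cong-mod ([times-a]ʰ i) (mod-refl {N} {1})) (-1*1≡-1-mod aʰ≡-1 iʰ≡1)))
    (λ i j i<N j<N _ _ → times-a-injective i j i<N j<N)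

  #non-residues≤#residues : #non-residues ≤ #residues
  #non-residues≤#residues = count-injection (∁? (p ∣?_) ∩? ∁? residue?) (∁? (p ∣?_) ∩? residue?) N times-a
    (λ i _ (p∤i , iʰ≢1) → m%n<n (a * i) N , times-a-unit p∤i ,
       mod-trans ([times-a]ʰ i) (-1*-1≡1-mod aʰ≡-1 ([ (λ iʰ≡1 → ⊥-elim (iʰ≢1 iʰ≡1)) , id ]′ (x^h≡±1 p∤i))))
    (λ i j i<N j<N _ _ → times-a-injective i j i<N j<N)

  #residues+#non-residues : #residues + #non-residues ≡ h + h
  #residues+#non-residues = begin
    #residues + #non-residues       ≡⟨ count-split (∁? (p ∣?_)) residue? N ⟨
    count (∁? (p ∣?_)) N            ≡⟨ totient≡#non-multiples r p-prime ⟨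
    totient N                       ≡⟨ totient-N ⟩
    h + h                           ∎
    where open ≡-Reasoning

  #residues≡h : #residues ≡ h
  #residues≡h = m+m≡n+n⇒m≡n
    (trans (cong (#residues +_) (≤-antisym #residues≤#non-residues #non-residues≤#residues))
           #residues+#non-residues)

  count-Counted : count counted? N ≡ p ^ r + h
  count-Counted = begin
    count counted? N                                                  ≡⟨ count-split counted? (p ∣?_) N ⟩
    count (counted? ∩? (p ∣?_)) N + count (counted? ∩? ∁? (p ∣?_)) N ≡⟨ cong₂ _+_ multiples units ⟩
    count (p ∣?_) N + #residues                                       ≡⟨ cong₂ _+_ (count-multiples p (p ^ r))
                                                                                   #residues≡h ⟩
    p ^ r + h                                                         ∎
    where
    open ≡-Reasoning
    multiples : count (counted? ∩? (p ∣?_)) N ≡ count (p ∣?_) N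
    multiples = count-cong (counted? ∩? (p ∣?_)) (p ∣?_) N λ _ _ → mk⇔ proj₂ (λ p∣i → inj₁ p∣i , p∣i)
    units : count (counted? ∩? ∁? (p ∣?_)) N ≡ #residues
    units = count-cong (counted? ∩? ∁? (p ∣?_)) (∁? (p ∣?_) ∩? residue?) N λ _ _ → mk⇔
      (λ { (inj₁ p∣i , p∤i) → ⊥-elim (p∤i p∣i) ; (inj₂ iʰ≡1 , p∤i) → p∤i , iʰ≡1 })
      (λ (p∤i , iʰ≡1) → inj₂ iʰ≡1 , p∤i)

  IsCounted⇔Counted : ∀ x → IsCounted N x ⇔ Counted (toℕ x)
  IsCounted⇔Counted x = mk⇔ (IsPowerPeriod⇒Counted ∣-refl ∘ Equivalence.to counted⇔period)
                            (Equivalence.from counted⇔period ∘ Counted⇒IsPowerPeriod)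
    where counted⇔period = IsCounted⇔IsPowerPeriod N ⌈totient-N/2⌉≡h x

  p^r[p+1]≡2[p^r+h] : p ^ r * (p + 1) ≡ 2 * (p ^ r + h)
  p^r[p+1]≡2[p^r+h] = trans (cong (λ q → p ^ r * (q + 1)) p≡1+2t) (expand t (p ^ r))
    where
    expand : ∀ t q → q * (suc (t + t) + 1) ≡ 2 * (q + t * q)
    expand = solve-∀

  MEquals-N : MEquals N ((p ^ r * (p + 1)) / 2)
  MEquals-N = count⇒MEquals N counted? IsCounted⇔Counted (begin
    count counted? N              ≡⟨ count-Counted ⟩
    p ^ r + h                     ≡⟨ m*n/n≡m (p ^ r + h) 2 ⟨
    (p ^ r + h) * 2 / 2           ≡⟨ cong (_/ 2) (trans (*-comm (p ^ r + h) 2) (sym p^r[p+1]≡2[p^r+h])) ⟩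
    (p ^ r * (p + 1)) / 2         ∎)
    where open ≡-Reasoning

  2⊥N : Coprime 2 N
  2⊥N = coprime-sym (prime∤⇒coprime-^ (suc r) p-prime (p≢2 ∘ prime∣prime⇒≡ prime[2] p-prime))

  ⌈totient-2N/2⌉≡h : ⌈ totient (2 * N) /2⌉ ≡ h
  ⌈totient-2N/2⌉≡h = begin
    ⌈ totient (2 * N) /2⌉          ≡⟨ cong ⌈_/2⌉ (totient-* 2 N 2⊥N) ⟩
    ⌈ totient 2 * totient N /2⌉    ≡⟨ cong ⌈_/2⌉ (*-identityˡ (totient N)) ⟩
    ⌈ totient N /2⌉                ≡⟨ ⌈totient-N/2⌉≡h ⟩
    h                              ∎
    where open ≡-Reasoning

  IsCounted-2N⇔Counted : ∀ x → IsCounted (2 * N) x ⇔ Counted (toℕ x)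
  IsCounted-2N⇔Counted x = mk⇔
    (IsPowerPeriod⇒Counted (n∣m*n 2) ∘ Equivalence.to counted⇔period)
    (Equivalence.from counted⇔period ∘ λ counted →
      let k , k≥1 , period-N = Counted⇒IsPowerPeriod counted
      in k , k≥1 , chinese-remainder 2⊥N (^[k+H]≡^k-mod2 (toℕ x) h k k≥1) period-N)
    where counted⇔period = IsCounted⇔IsPowerPeriod (2 * N) ⌈totient-2N/2⌉≡h x

  Counted-periodic : ∀ i → Counted (N + i) ⇔ Counted i
  Counted-periodic i = mk⇔
    [ (λ p∣N+i → inj₁ (∣m+n∣m⇒∣n p∣N+i p∣N)) , (λ [N+i]ʰ≡1 → inj₂ (mod-trans (mod-sym [N+i]ʰ≡iʰ) [N+i]ʰ≡1)) ]′
    [ (λ p∣i → inj₁ (∣m∣n⇒∣m+n p∣N p∣i)) , (λ iʰ≡1 → inj₂ (mod-trans [N+i]ʰ≡iʰ iʰ≡1)) ]′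
    where
    [N+i]ʰ≡iʰ : (N + i) ^ h ≡ i ^ h mod N
    [N+i]ʰ≡iʰ = ^-cong-mod h (+-cong-mod n≡0-mod (mod-refl {N} {i}))

  MEquals-2N : MEquals (2 * N) (p ^ r * (p + 1))
  MEquals-2N = count⇒MEquals (2 * N) counted? IsCounted-2N⇔Counted (begin
    count counted? (2 * N)        ≡⟨ count-periodic counted? N 2 Counted-periodic ⟩
    2 * count counted? N          ≡⟨ cong (2 *_) count-Counted ⟩
    2 * (p ^ r + h)               ≡⟨ p^r[p+1]≡2[p^r+h] ⟨
    p ^ r * (p + 1)               ∎)
    where open ≡-Reasoning

-- The other moduli

period-mod-prime-power : ∀ {q s n H} x → Prime q → s ≤ n → (¬ q ∣ x → x ^ H ≡ 1 mod q ^ s) →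
                         x ^ (n + H) ≡ x ^ n mod q ^ s
period-mod-prime-power {q} {s} {n} {H} x q-prime s≤n units-killed with q ∣? x
... | yes q∣x = ^≡0⇒^+≡^ x n H (∣⇒≡0-mod (∣-trans (^-monoˡ-∣ s q∣x) (^-monoʳ-∣ x s≤n)))
... | no  q∤x = ^≡1⇒^+≡^ x n H (units-killed q∤x)

powers-periodic : ∀ {n H} → 0 < n →
                  (∀ {q s x} → Prime q → 0 < s → q ^ s ∣ n → ¬ q ∣ x → x ^ H ≡ 1 mod q ^ s) →
                  ∀ x → x ^ (n + H) ≡ x ^ n mod n
powers-periodic {n} {H} 0<n units-killed x = <-rec P step n ∣-refl
  where
  P : ℕ → Set
  P m = m ∣ n → x ^ (n + H) ≡ x ^ n mod m
  step : ∀ m → (∀ {k} → k < m → P k) → P m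
  step zero          _   0∣n = ⊥-elim (<⇒≢ 0<n (sym (0∣⇒≡0 0∣n)))
  step (suc zero)    _   _   = ≡-mod1 _ _
  step m@(2+ m-2) rec m∣n =
    let q , s , c , q-prime , s>0 , m≡q^s*c , q∤c = ∃prime-power-factor m (s≤s (s≤s z≤n))
        q^s∣n = ∣-trans (divides c (trans m≡q^s*c (*-comm (q ^ s) c))) m∣n
        c∣n = ∣-trans (divides (q ^ s) m≡q^s*c) m∣n
        s≤n = <⇒≤ (<-≤-trans (n<m^n s (prime>1 q-prime)) (∣⇒≤ {{>-nonZero 0<n}} q^s∣n))
        c<m = cofactor< (prime>1 q-prime) s>0 z<s m≡q^s*c
    in subst (λ k → x ^ (n + H) ≡ x ^ n mod k) (sym m≡q^s*c)
         (chinese-remainder (prime∤⇒coprime-^ s q-prime q∤c)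
           (period-mod-prime-power x q-prime s≤n (units-killed q-prime s>0 q^s∣n))
           (rec c<m c∣n))

odd²≡1-mod8 : ∀ x → ¬ 2 ∣ x → x * x ≡ 1 mod 8
odd²≡1-mod8 x 2∤x with odd⇒≡1+2t 2∤x
... | t , refl with even⊎odd t
...   | u , inj₁ refl = mod-trans (mod-reflexive (expand u)) (m+kn≡m-mod 1 (2 * u * u + u))
  where
  expand : ∀ u → suc ((u + u) + (u + u)) * suc ((u + u) + (u + u)) ≡ 1 + (2 * u * u + u) * 8
  expand = solve-∀
...   | u , inj₂ refl = mod-trans (mod-reflexive (expand u)) (m+kn≡m-mod 1 (2 * u * u + 3 * u + 1))
  where
  expand : ∀ u → suc (suc (u + u) + suc (u + u)) * suc (suc (u + u) + suc (u + u)) ≡ 1 + (2 * u * u + 3 * u + 1) * 8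
  expand = solve-∀

square-≡1-mod-double : ∀ M y → y ≡ 1 mod 2 * M → y * y ≡ 1 mod 2 * (2 * M)
square-≡1-mod-double M y (i , j , y+i2M≡1+j2M) = i * (y + i * M) , j * (1 + j * M) , (begin
  y * y + i * (y + i * M) * (2 * (2 * M)) ≡⟨ expandˡ y i M ⟩
  (y + i * (2 * M)) * (y + i * (2 * M))   ≡⟨ cong₂ _*_ y+i2M≡1+j2M y+i2M≡1+j2M ⟩
  (1 + j * (2 * M)) * (1 + j * (2 * M))   ≡⟨ expandʳ j M ⟩
  1 + j * (1 + j * M) * (2 * (2 * M))     ∎)
  where
  open ≡-Reasoning
  expandˡ : ∀ y i M → y * y + i * (y + i * M) * (2 * (2 * M)) ≡ (y + i * (2 * M)) * (y + i * (2 * M))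
  expandˡ = solve-∀
  expandʳ : ∀ j M → (1 + j * (2 * M)) * (1 + j * (2 * M)) ≡ 1 + j * (1 + j * M) * (2 * (2 * M))
  expandʳ = solve-∀

odd^2^[1+S]≡1 : ∀ S x → ¬ 2 ∣ x → x ^ (2 ^ suc S) ≡ 1 mod 2 ^ (3 + S)
odd^2^[1+S]≡1 zero    x 2∤x = mod-trans (mod-reflexive (cong (x *_) (*-identityʳ x))) (odd²≡1-mod8 x 2∤x)
odd^2^[1+S]≡1 (suc S) x 2∤x = mod-trans (mod-reflexive (x^[2k]≡[x^k]² (2 ^ suc S)))
  (square-≡1-mod-double (2 ^ (2 + S)) (x ^ (2 ^ suc S)) (odd^2^[1+S]≡1 S x 2∤x))
  where
  x^[2k]≡[x^k]² : ∀ k → x ^ (2 * k) ≡ x ^ k * x ^ k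
  x^[2k]≡[x^k]² k = trans (cong (x ^_) (cong (k +_) (+-identityʳ k))) (^-distribˡ-+-* x k k)

⌈totient-2^[3+S]/2⌉ : ∀ S → ⌈ totient (2 ^ (3 + S)) /2⌉ ≡ 2 ^ suc S
⌈totient-2^[3+S]/2⌉ S = trans (cong ⌈_/2⌉ totient≡K+K) (⌈n+n/2⌉≡n K)
  where
  K = 2 ^ suc S
  double : ∀ k → 2 * k ≡ k + k
  double k = cong (k +_) (+-identityʳ k)
  totient≡K+K : totient (2 ^ (3 + S)) ≡ K + K
  totient≡K+K = trans (+-cancelʳ-≡ (2 ^ (2 + S)) _ _
                        (trans (totient-prime-power (2 + S) prime[2]) (double (2 ^ (2 + S)))))
                      (double K)

odd-power-of-two-period : ∀ S x → 0 < S → 2 ^ S ≢ 4 → ¬ 2 ∣ x → x ^ ⌈ totient (2 ^ S) /2⌉ ≡ 1 mod 2 ^ S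
odd-power-of-two-period 1 x _ _ 2∤x = mod-trans (mod-reflexive (*-identityʳ x)) (odd⇒≡1-mod2 x 2∤x)
odd-power-of-two-period 2 x _ 2²≢4 _ = ⊥-elim (2²≢4 refl)
odd-power-of-two-period (suc (suc (suc S))) x _ _ 2∤x =
  subst (λ H → x ^ H ≡ 1 mod 2 ^ (3 + S)) (sym (⌈totient-2^[3+S]/2⌉ S)) (odd^2^[1+S]≡1 S x 2∤x)

cofactor-period : ∀ {q S c} x → Prime q → 2 < c → ¬ q ∣ c → ¬ q ∣ x →
                  x ^ ⌈ totient (q ^ S * c) /2⌉ ≡ 1 mod q ^ S
cofactor-period {q} {S} {c} x q-prime 2<c q∤c q∤x = begin
  x ^ ⌈ totient (q ^ S * c) /2⌉   ≡⟨ cong (x ^_) H≡φ*u ⟩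
  x ^ (totient (q ^ S) * u)       ≡⟨ ^-*-assoc x (totient (q ^ S)) u ⟨
  (x ^ totient (q ^ S)) ^ u       ≈⟨ ^-≡1-mod u (euler (coprime-sym (prime∤⇒coprime-^ S q-prime q∤x))) ⟩
  1                               ∎
  where
  open ≡-mod-Reasoning (q ^ S)
  instance
    q^S≢0 : NonZero (q ^ S)
    q^S≢0 = m^n≢0 q S {{prime⇒nonZero q-prime}}
    c≢0 : NonZero c
    c≢0 = >-nonZero (≤-trans (s≤s z≤n) 2<c)
  u = proj₁ (totient-even c 2<c)
  H≡φ*u : ⌈ totient (q ^ S * c) /2⌉ ≡ totient (q ^ S) * u
  H≡φ*u = trans (cong ⌈_/2⌉ (trans (totient-* (q ^ S) c (prime∤⇒coprime-^ S q-prime q∤c))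
                                   (trans (cong (totient (q ^ S) *_) (proj₂ (totient-even c 2<c)))
                                          (*-distribˡ-+ (totient (q ^ S)) u u))))
                (⌈n+n/2⌉≡n (totient (q ^ S) * u))

module GenericModulus (n : ℕ) .{{_ : NonZero n}} (n≢4 : n ≢ 4)
                      (not-odd : ¬ (∃[ p ] ∃[ r ] OddPrimePower n p r))
                      (not-twice : ¬ (∃[ p ] ∃[ r ] TwiceOddPrimePower n p r)) where

  H : ℕ
  H = ⌈ totient n /2⌉

  units-killed-exact : ∀ {q S c} x → Prime q → 0 < S → n ≡ q ^ S * c → ¬ q ∣ c → ¬ q ∣ x →
                       x ^ H ≡ 1 mod q ^ S
  units-killed-exact {q} {S} {c} x q-prime S>0 n≡q^S*c q∤c q∤x =
    subst (λ m → x ^ ⌈ totient m /2⌉ ≡ 1 mod q ^ S) (sym n≡q^S*c) (by-cofactor c q∤c n≡q^S*c)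
    where
    by-cofactor : ∀ c → ¬ q ∣ c → n ≡ q ^ S * c → x ^ ⌈ totient (q ^ S * c) /2⌉ ≡ 1 mod q ^ S
    by-cofactor 0 _ n≡0 = ⊥-elim (≢-nonZero⁻¹ n (trans n≡0 (*-zeroʳ (q ^ S))))
    by-cofactor 1 _ n≡q^S with q ≟ 2
    ... | yes refl = subst (λ m → x ^ ⌈ totient m /2⌉ ≡ 1 mod 2 ^ S) (sym (*-identityʳ (2 ^ S)))
                       (odd-power-of-two-period S x S>0 (n≢4 ∘ trans n≡q^S ∘ trans (*-identityʳ _)) q∤x)
    ... | no q≢2 = ⊥-elim (not-odd (q , S , q-prime , q≢2 , S>0 , trans n≡q^S (*-identityʳ (q ^ S))))
    by-cofactor 2 q∤2 n≡q^S*2 with q ≟ 2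
    ... | yes refl = ⊥-elim (q∤2 ∣-refl)
    ... | no q≢2 = ⊥-elim (not-twice (q , S , q-prime , q≢2 , S>0 , trans n≡q^S*2 (*-comm (q ^ S) 2)))
    by-cofactor (suc (suc (suc _))) q∤c _ = cofactor-period {S = S} x q-prime (s≤s (s≤s (s≤s z≤n))) q∤c q∤x

  units-killed : ∀ {q s x} → Prime q → 0 < s → q ^ s ∣ n → ¬ q ∣ x → x ^ H ≡ 1 mod q ^ s
  units-killed {q} {s} {x} q-prime s>0 q^s∣n q∤x = via (factor-out q (prime>1 q-prime) n (>-nonZero⁻¹ n))
    where
    via : (∃₂ λ S c → n ≡ q ^ S * c × ¬ q ∣ c) → x ^ H ≡ 1 mod q ^ s
    via (S , c , n≡q^S*c , q∤c) = mod-∣ q^s∣q^S (units-killed-exact x q-prime S>0 n≡q^S*c q∤c q∤x)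
      where
      q^s∣q^S : q ^ s ∣ q ^ S
      q^s∣q^S = coprime-divisor (prime∤⇒coprime-^ s q-prime q∤c)
                                (subst (q ^ s ∣_) (trans n≡q^S*c (*-comm (q ^ S) c)) q^s∣n)
      S>0 : 0 < S
      S>0 = n≢0⇒n>0 λ S≡0 → q∤c (subst (q ∣_) (trans n≡q^S*c (trans (cong (λ e → q ^ e * c) S≡0) (*-identityˡ c)))
                                          (∣-trans (m∣m^n {q} s>0) q^s∣n))

  MEquals-n : MEquals n n
  MEquals-n = count⇒MEquals n {P = λ _ → ⊤} (λ _ → yes tt)
    (λ x → mk⇔ (λ _ → tt) (λ _ → Equivalence.from (IsCounted⇔IsPowerPeriod n refl x)
                                   (n , >-nonZero⁻¹ n , powers-periodic (>-nonZero⁻¹ n) units-killed (toℕ x))))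
    (count-all (λ _ → yes tt) n (λ _ _ → tt))

-- The modulus 4

3-not-counted-mod4 : ¬ IsPowerPeriod 4 1 3
3-not-counted-mod4 (k , _ , 3ᵏ⁺¹≡3ᵏ) =
  3≢1 (<∧≡-mod⇒≡ ≤-refl (s≤s (s≤s z≤n)) (mod-cancelˡ 4⊥3ᵏ (begin
  3 ^ k * 3     ≡⟨ ^-distribˡ-+-* 3 k 1 ⟨
  3 ^ (k + 1)   ≈⟨ 3ᵏ⁺¹≡3ᵏ ⟩
  3 ^ k         ≡⟨ *-identityʳ (3 ^ k) ⟨
  3 ^ k * 1     ∎)))
  where
  open ≡-mod-Reasoning 4
  3≢1 : 3 ≢ 1
  3≢1 ()
  4⊥3ᵏ : Coprime 4 (3 ^ k)
  4⊥3ᵏ = coprime-sym (coprime-^ˡ k (coprime-sym (coprime-+ (1-coprimeTo 3))))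

MEquals-4 : MEquals 4 3
MEquals-4 = count⇒MEquals 4 (λ i → ¬? (i ≟ 3)) counted⇔≢3 refl
  where
  counted⇔≢3 : ∀ x → IsCounted 4 x ⇔ toℕ x ≢ 3
  counted⇔≢3 Fin.zero                         = mk⇔ (λ _ ()) (λ _ → 1 , s≤s z≤n , refl)
  counted⇔≢3 (fsuc Fin.zero)                  = mk⇔ (λ _ ()) (λ _ → 1 , s≤s z≤n , refl)
  counted⇔≢3 (fsuc (fsuc Fin.zero))           = mk⇔ (λ _ ()) (λ _ → 2 , s≤s z≤n , refl)
  counted⇔≢3 (fsuc (fsuc (fsuc Fin.zero)))    =
    mk⇔ (λ counted → ⊥-elim (3-not-counted-mod4 (Equivalence.to (IsCounted⇔IsPowerPeriod 4 refl _) counted)))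
        (λ 3≢3 → ⊥-elim (3≢3 refl))

odd-prime⇒≡1+2t : ∀ {p} → Prime p → p ≢ 2 → ∃[ t ] p ≡ suc (t + t)
odd-prime⇒≡1+2t p-prime p≢2 = odd⇒≡1+2t (p≢2 ∘ sym ∘ prime∣prime⇒≡ p-prime prime[2])

case-4 : ∀ n .{{_ : NonZero n}} → n ≡ 4 → MEquals n 3
case-4 .4 refl = MEquals-4

case-odd-prime-power : ∀ n .{{_ : NonZero n}} p r → OddPrimePower n p r → MEquals n ((p ^ (r ∸ 1) * (p + 1)) / 2)
case-odd-prime-power n p zero    (_ , _ , () , _)
case-odd-prime-power n p (suc r) (p-prime , p≢2 , _ , refl) with t , p≡1+2t ← odd-prime⇒≡1+2t p-prime p≢2 =
  OddPrimePowerModulus.MEquals-N {t = t} p-prime p≡1+2t r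

case-twice-odd-prime-power : ∀ n .{{_ : NonZero n}} p r → TwiceOddPrimePower n p r →
                             MEquals n (p ^ (r ∸ 1) * (p + 1))
case-twice-odd-prime-power n p zero    (_ , _ , () , _)
case-twice-odd-prime-power n p (suc r) (p-prime , p≢2 , _ , refl) with t , p≡1+2t ← odd-prime⇒≡1+2t p-prime p≢2 =
  OddPrimePowerModulus.MEquals-2N {t = t} p-prime p≡1+2t r

mainTheorem3 : (n : ℕ) → .{{_ : NonZero n}} →
      ((n ≡ 4) → MEquals n 3)
    × ((p r : ℕ) → OddPrimePower n p r → MEquals n ((p ^ (r ∸ 1) * (p + 1)) / 2))
    × ((p r : ℕ) → TwiceOddPrimePower n p r → MEquals n (p ^ (r ∸ 1) * (p + 1)))
    × (¬ (n ≡ 4) → ¬ (∃[ p ] ∃[ r ] OddPrimePower n p r)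
        → ¬ (∃[ p ] ∃[ r ] TwiceOddPrimePower n p r) → MEquals n n)
mainTheorem3 n = case-4 n , case-odd-prime-power n , case-twice-odd-prime-power n , GenericModulus.MEquals-n n
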